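{- Let $\Delta$ be a simplicial complex on $[n]$, $X\in\mathscr{C}_{n,k}(\Delta)$ and $Y\in\mathscr{C}_{n,j}(X)$. Then any two of the following conditions imply the third: (i) $|X_k|-|Y_k|=\operatorname{rank}\partial_k^{\Delta/Y}$; (ii) $\beta_{k-1}(X,Y)=\beta_{k-1}(\Delta,Y)$; (iii) $\beta_k(X,Y)=0$.
   Context: A $j$-face on $[n]$ is a subset of size $j+1$; a simplicial complex on $[n]$ is a nonempty family of subsets closed under taking subsets; $X_j$ is the set of $j$-faces of $X$, and $K_n^k$ the family of all subsets of $[n]$ of size at most $k+1$. For a complex $\Delta$, $\mathscr{C}_{n,k}(\Delta):=\{X: K_n^{k-1}\cap\Delta\subseteq X\subseteq K_n^k\cap\Delta\}$. Faces are oriented by the increasing order; $\partial$ is the oriented boundary matrix (rows $(i-1)$-faces, columns $i$-faces, entry $(-1)^l$ if $\sigma=\tau\setminus\{\tau_l\}$ with $\tau=\{\tau_0<\dots<\tau_i\}$, else $0$), and $M_{A,B}$ is the submatrix with rows $A$ and columns $B$. For complexes $Y\subseteq X$, $\partial_i^{X/Y}:=\partial_{X_{i-1}\setminus Y_{i-1},X_i\setminus Y_i}$, the relative homology $H_i(X,Y)$ is the homology of the chain complex $(\mathbb{Z}^{X_i\setminus Y_i},\partial_i^{X/Y})$, and $\beta_i(X,Y)$ is the rank of its free part. -}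

module Defs where

open import Data.Nat as ℕ using (ℕ; zero; suc; _≤_; _≡ᵇ_; _<ᵇ_)
open import Data.Integer as ℤ using (ℤ; 0ℤ; 1ℤ; -1ℤ)
open import Data.Bool using (Bool; true; false; _∧_; not; if_then_else_)
import Data.Bool.Properties as BoolP
open import Data.Fin using (Fin; toℕ)
open import Data.Fin.Subset using (Subset; _∉_; _⊆_; ∣_∣; ⁅_⁆; _∪_; _∩_)
open import Data.Fin.Subset.Properties using (_∈?_)
open import Data.Vec using (Vec; []; _∷_; tabulate)
open import Data.Vec.Properties using (≡-dec)
open import Data.Product using (Σ; ∃; _×_)
open import Data.Unit using (⊤)
open import Relation.Nullary using (¬_; yes; no)
open import Relation.Binary.PropositionalEquality using (_≡_)

Family : ℕ → Set
Family n = Subset n → Bool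

_∈F_ : ∀ {n} → Subset n → Family n → Set
σ ∈F F = F σ ≡ true

record IsComplex {n : ℕ} (F : Family n) : Set where
  field
    nonempty : ∃ λ σ → σ ∈F F
    closed   : ∀ σ τ → σ ⊆ τ → τ ∈F F → σ ∈F F

-- X ∈ 𝒞_{n,k}(Δ):  K_n^{k-1} ∩ Δ ⊆ X ⊆ K_n^k ∩ Δ
-- (K_n^k = subsets of size ≤ k+1), X a simplicial complex.
InC : ∀ {n} → ℕ → Family n → Family n → Set
InC k Δ X =
  IsComplex X
  × (∀ σ → ∣ σ ∣ ≤ k → σ ∈F Δ → σ ∈F X)
  × (∀ σ → σ ∈F X → (σ ∈F Δ × ∣ σ ∣ ≤ suc k))

sumSubℤ : ∀ {n} → (Subset n → ℤ) → ℤ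
sumSubℤ {zero}  f = f []
sumSubℤ {suc n} f = sumSubℤ (λ s → f (false ∷ s)) ℤ.+ sumSubℤ (λ s → f (true ∷ s))

sumSubℕ : ∀ {n} → (Subset n → ℕ) → ℕ
sumSubℕ {zero}  f = f []
sumSubℕ {suc n} f = sumSubℕ (λ s → f (false ∷ s)) ℕ.+ sumSubℕ (λ s → f (true ∷ s))

sumFinℤ : ∀ {n} → (Fin n → ℤ) → ℤ
sumFinℤ {zero}  f = 0ℤ
sumFinℤ {suc n} f = f Fin.zero ℤ.+ sumFinℤ (λ i → f (Fin.suc i))
  where import Data.Fin as Fin

-- number of faces of F of size s (i.e. of dimension s-1)
count : ∀ {n} → Family n → ℕ → ℕ
count F s = sumSubℕ (λ σ → if F σ ∧ (∣ σ ∣ ≡ᵇ s) then 1 else 0)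

sign : ℕ → ℤ
sign zero          = 1ℤ
sign (suc zero)    = -1ℤ
sign (suc (suc l)) = sign l

below : ∀ {n} → Fin n → Subset n
below v = tabulate (λ u → toℕ u <ᵇ toℕ v)

-- entry of the oriented boundary matrix in row σ, column τ:
-- (-1)^l if σ = τ \ {τ_l} (τ_0 < … < τ_i in increasing order), else 0.
-- Here τ_l = v, with τ = σ ∪ {v}, v ∉ σ, and l = #{u ∈ τ : u < v}.
incidence : ∀ {n} → Subset n → Subset n → ℤ
incidence {n} σ τ = sumFinℤ term
  where
  term : Fin n → ℤ
  term v with v ∈? σ | ≡-dec BoolP._≟_ τ (σ ∪ ⁅ v ⁆)
  ... | no _  | yes _ = sign ∣ τ ∩ below v ∣
  ... | _     | _     = 0ℤ

Chain : ℕ → Set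
Chain n = Subset n → ℤ

-- indicator of X_{s-1} \ Y_{s-1} (faces of size s)
rel : ∀ {n} → Family n → Family n → ℕ → Subset n → Bool
rel X Y s σ = X σ ∧ not (Y σ) ∧ (∣ σ ∣ ≡ᵇ s)

Supp : ∀ {n} → Family n → Family n → ℕ → Chain n → Set
Supp X Y s c = ∀ σ → rel X Y s σ ≡ false → c σ ≡ 0ℤ

-- ∂^{X/Y} applied to a chain on faces of size suc r, giving a chain on faces of
-- size r: the matrix ∂_{X_{r-1}\Y_{r-1}, X_r\Y_r} (dimensions r-1, r) times c.
bd : ∀ {n} → Family n → Family n → ℕ → Chain n → Chain n
bd X Y r c σ =
  if rel X Y r σ
  then sumSubℤ (λ τ → incidence σ τ ℤ.* (if rel X Y (suc r) τ then c τ else 0ℤ))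
  else 0ℤ

lincomb : ∀ {n m} → (Fin m → ℤ) → (Fin m → Chain n) → Chain n
lincomb c z σ = sumFinℤ (λ a → c a ℤ.* z a σ)

unit : ∀ {n} → Subset n → Chain n
unit σ τ with ≡-dec BoolP._≟_ σ τ
... | yes _ = 1ℤ
... | no  _ = 0ℤ

IsMax : (ℕ → Set) → ℕ → Set
IsMax P b = P b × (∀ m → P m → m ≤ b)

-- rank of ∂^{X/Y} from faces of size suc r (dimension r) to size r:
-- maximum number of ℤ-linearly independent columns.
IndepCols : ∀ {n} → Family n → Family n → ℕ → ℕ → Set
IndepCols {n} X Y r m =
  Σ (Fin m → Subset n) λ τ →
    (∀ a → rel X Y (suc r) (τ a) ≡ true)
    × (∀ (c : Fin m → ℤ) →
         (∀ σ → bd X Y r (lincomb c (λ a → unit (τ a))) σ ≡ 0ℤ) →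
         ∀ a → c a ≡ 0ℤ)

RankBd : ∀ {n} → Family n → Family n → ℕ → ℕ → Set
RankBd X Y r = IsMax (IndepCols X Y r)

-- relative cycles of size s (dimension s-1); the size-0 (dimension -1) boundary is zero
IsCycle : ∀ {n} → Family n → Family n → ℕ → Chain n → Set
IsCycle X Y zero    c = ⊤
IsCycle X Y (suc r) c = ∀ σ → bd X Y r c σ ≡ 0ℤ

IsBoundary : ∀ {n} → Family n → Family n → ℕ → Chain n → Set
IsBoundary X Y s c = ∃ λ d → Supp X Y (suc s) d × (∀ σ → bd X Y s d σ ≡ c σ)

IndepHom : ∀ {n} → Family n → Family n → ℕ → ℕ → Set
IndepHom {n} X Y s m =
  Σ (Fin m → Chain n) λ z →
    (∀ a → Supp X Y s (z a) × IsCycle X Y s (z a))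
    × (∀ (c : Fin m → ℤ) → IsBoundary X Y s (lincomb c z) → ∀ a → c a ≡ 0ℤ)

-- Betti X Y s b : b = β_{s-1}(X,Y), rank of the free part of H_{s-1}(X,Y)
-- (= maximal size of a ℤ-linearly independent family in H_{s-1}(X,Y))
Betti : ∀ {n} → Family n → Family n → ℕ → ℕ → Set
Betti X Y s = IsMax (IndepHom X Y s)

-- Write D for the relative boundary map ∂ₖ^{Δ/Y}, and W = Xₖ ∖ Yₖ ⊆ V = Δₖ ∖ Yₖ. As X agrees with
-- Δ below dimension k and has nothing above it, Hₖ(X,Y) = ker (D on ℤ^W), while H_{k-1}(X,Y) and
-- H_{k-1}(Δ,Y) are the relative (k-1)-cycles Z modulo D(ℤ^W) and D(ℤ^V). With ρ the rank of D on ℤ^W,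
-- rank–nullity gives ρ + βₖ(X,Y) = |W| = |Xₖ| - |Yₖ|, and computing the rank of Z in two ways gives
-- ρ + β_{k-1}(X,Y) = rank D + β_{k-1}(Δ,Y) (every D(unit σ), σ ∈ V, lies in Z because ∂∂ = 0).
-- Any two of (i)–(iii) then force the third.
-- Ranks are maximal sizes of ℤ-independent families and are compared by Steinitz exchange over the
-- rational span. Maximal families, and dependences among non-independent ones, exist only up to double
-- negation, so the argument runs in the ¬¬ monad; its conclusions are equations of naturals, hence stable.
module Submission where

open import Defs
import Algebra.Properties.CommutativeSemigroup as CommSemigroupProperties
open import Data.Bool using (Bool; true; false; _∧_; not; if_then_else_; T)
import Data.Bool.Properties as BoolP
open import Data.Fin as Fin using (Fin; zero; suc; toℕ; punchIn; _↑ˡ_; _↑ʳ_; splitAt)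
import Data.Fin.Properties as FinP
open import Data.Fin.Subset using (Subset; ∣_∣; _∪_; _∩_; ⁅_⁆; _∈_; _∉_; ⊤)
open import Data.Fin.Subset.Properties using (_∈?_)
import Data.Fin.Subset.Properties as SubsetP
open import Data.Integer as ℤ using (ℤ; 0ℤ; 1ℤ; _+_; _*_; -_; _-_)
import Data.Integer.Properties as ℤP
open import Data.Integer.Tactic.RingSolver using (solve-∀)
open import Data.Nat as ℕ using (ℕ; zero; suc; _≤_; _<_; s≤s; _≡ᵇ_; _<ᵇ_)
import Data.Nat.Properties as ℕP
open import Data.Product using (Σ; ∃; _×_; _,_; proj₁; proj₂)
open import Data.Sum using (inj₁; inj₂)
open import Data.Unit using (tt)
open import Data.Vec using ([]; _∷_; tail; here; there)
open import Data.Vec.Properties using (≡-dec)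
import Data.Vec.Properties as VecP
open import Data.Vec.Functional as Vector using (_++_; insertAt)
import Data.Vec.Functional.Properties as VectorP
open import Effect.Monad using (RawMonad)
open import Function using (_∘_; id; Equivalence)
open import Level using (0ℓ)
open import Relation.Binary.Definitions using (tri<; tri≈; tri>)
open import Relation.Binary.PropositionalEquality
open import Relation.Nullary using (¬_; Dec; yes; no)
open import Relation.Nullary.Decidable using (decidable-stable; ¬¬-excluded-middle; ¬?; _×-dec_)
open import Relation.Nullary.Negation using (contradiction; ¬¬-Monad)

open import Algebra.Properties.AbelianGroup ℤP.+-0-abelianGroup using (inverseˡ-unique; inverseʳ-unique)
module ℤ+ = CommSemigroupProperties ℤP.+-commutativeSemigroup
module ℤ* = CommSemigroupProperties ℤP.*-commutativeSemigroup
module ℕ+ = CommSemigroupProperties ℕP.+-commutativeSemigroup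

open RawMonad (¬¬-Monad {a = 0ℓ})

private
  variable
    n m p q : ℕ

*-cancelˡ-≡0 : ∀ {i j} → i ≢ 0ℤ → i * j ≡ 0ℤ → j ≡ 0ℤ
*-cancelˡ-≡0 {i} i≢0 ij≡0 with ℤP.i*j≡0⇒i≡0∨j≡0 i ij≡0
... | inj₁ i≡0 = contradiction i≡0 i≢0
... | inj₂ j≡0 = j≡0

*-≢0 : ∀ {i j} → i ≢ 0ℤ → j ≢ 0ℤ → i * j ≢ 0ℤ
*-≢0 i≢0 j≢0 ij≡0 = j≢0 (*-cancelˡ-≡0 i≢0 ij≡0)

-- Finite sums

sumFinℤ-cong : {f g : Fin m → ℤ} → (∀ i → f i ≡ g i) → sumFinℤ f ≡ sumFinℤ g
sumFinℤ-cong {zero}  e = refl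
sumFinℤ-cong {suc m} e = cong₂ _+_ (e zero) (sumFinℤ-cong (e ∘ suc))

sumFinℤ-zero : {f : Fin m → ℤ} → (∀ i → f i ≡ 0ℤ) → sumFinℤ f ≡ 0ℤ
sumFinℤ-zero {zero}  e = refl
sumFinℤ-zero {suc m} e = cong₂ _+_ (e zero) (sumFinℤ-zero (e ∘ suc))

sumFinℤ-+ : (f g : Fin m → ℤ) → sumFinℤ (λ i → f i + g i) ≡ sumFinℤ f + sumFinℤ g
sumFinℤ-+ {zero}  f g = refl
sumFinℤ-+ {suc m} f g = trans (cong ((f zero + g zero) +_) (sumFinℤ-+ (f ∘ suc) (g ∘ suc)))
                              (ℤ+.interchange (f zero) (g zero) _ _)

sumFinℤ-*ˡ : ∀ x (f : Fin m → ℤ) → sumFinℤ (λ i → x * f i) ≡ x * sumFinℤ f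
sumFinℤ-*ˡ {zero}  x f = sym (ℤP.*-zeroʳ x)
sumFinℤ-*ˡ {suc m} x f = trans (cong (x * f zero +_) (sumFinℤ-*ˡ x (f ∘ suc)))
                               (sym (ℤP.*-distribˡ-+ x (f zero) _))

sumFinℤ-neg : (f : Fin m → ℤ) → sumFinℤ (λ i → - f i) ≡ - sumFinℤ f
sumFinℤ-neg {zero}  f = refl
sumFinℤ-neg {suc m} f = trans (cong (- f zero +_) (sumFinℤ-neg (f ∘ suc)))
                              (sym (ℤP.neg-distrib-+ (f zero) _))

sumFinℤ-comm : (f : Fin m → Fin p → ℤ) →
  sumFinℤ (λ i → sumFinℤ (f i)) ≡ sumFinℤ (λ j → sumFinℤ (λ i → f i j))
sumFinℤ-comm {zero} {p} f = sym (sumFinℤ-zero {p} (λ _ → refl))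
sumFinℤ-comm {suc m} f = trans (cong (sumFinℤ (f zero) +_) (sumFinℤ-comm (f ∘ suc)))
                               (sym (sumFinℤ-+ (f zero) (λ j → sumFinℤ (λ i → f (suc i) j))))

sumFinℤ-single : (f : Fin m → ℤ) (a : Fin m) → (∀ b → b ≢ a → f b ≡ 0ℤ) → sumFinℤ f ≡ f a
sumFinℤ-single f zero    h = trans (cong (f zero +_) (sumFinℤ-zero (λ b → h (suc b) λ ())))
                                   (ℤP.+-identityʳ (f zero))
sumFinℤ-single f (suc a) h = trans (cong (_+ sumFinℤ (f ∘ suc)) (h zero λ ()))
  (trans (ℤP.+-identityˡ _)
         (sumFinℤ-single (f ∘ suc) a (λ b b≢a → h (suc b) (b≢a ∘ FinP.suc-injective))))

sumFinℤ-punchIn : (f : Fin (suc m) → ℤ) (i : Fin (suc m)) →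
  sumFinℤ f ≡ f i + sumFinℤ (f ∘ punchIn i)
sumFinℤ-punchIn f zero = refl
sumFinℤ-punchIn {suc m} f (suc i) = trans (cong (f zero +_) (sumFinℤ-punchIn (f ∘ suc) i))
                                          (ℤ+.x∙yz≈y∙xz (f zero) (f (suc i)) _)

sumFinℤ-↑ : (f : Fin (p ℕ.+ q) → ℤ) →
  sumFinℤ f ≡ sumFinℤ (f ∘ (_↑ˡ q)) + sumFinℤ (f ∘ (p ↑ʳ_))
sumFinℤ-↑ {zero}  f = sym (ℤP.+-identityˡ _)
sumFinℤ-↑ {suc p} {q} f = trans (cong (f zero +_) (sumFinℤ-↑ {p} {q} (f ∘ suc)))
                            (sym (ℤP.+-assoc (f zero) _ _))

sumFinℤ-linear : ∀ x y (f g : Fin m → ℤ) →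
  sumFinℤ (λ i → x * f i - y * g i) ≡ x * sumFinℤ f - y * sumFinℤ g
sumFinℤ-linear x y f g = begin
  sumFinℤ (λ i → x * f i - y * g i)
    ≡⟨ sumFinℤ-+ (λ i → x * f i) (λ i → - (y * g i)) ⟩
  sumFinℤ (λ i → x * f i) + sumFinℤ (λ i → - (y * g i))
    ≡⟨ cong₂ _+_ (sumFinℤ-*ˡ x f) (trans (sumFinℤ-neg (λ i → y * g i)) (cong -_ (sumFinℤ-*ˡ y g))) ⟩
  x * sumFinℤ f - y * sumFinℤ g ∎
  where open ≡-Reasoning

sumFinℤ-antisymmetric : (M : Fin m → Fin m → ℤ) → (∀ v w → M v w + M w v ≡ 0ℤ) →
  sumFinℤ (λ v → sumFinℤ (M v)) ≡ 0ℤ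
sumFinℤ-antisymmetric M antisym = *-cancelˡ-≡0 {i = ℤ.+ 2} (λ ()) (begin
  ℤ.+ 2 * S
    ≡⟨ double S ⟩
  S + S
    ≡⟨ cong (S +_) (sumFinℤ-comm M) ⟩
  S + sumFinℤ (λ v → sumFinℤ (λ w → M w v))
    ≡⟨ sym (sumFinℤ-+ (λ v → sumFinℤ (M v)) _) ⟩
  sumFinℤ (λ v → sumFinℤ (M v) + sumFinℤ (λ w → M w v))
    ≡⟨ sumFinℤ-cong (λ v → sym (sumFinℤ-+ (M v) (λ w → M w v))) ⟩
  sumFinℤ (λ v → sumFinℤ (λ w → M v w + M w v))
    ≡⟨ sumFinℤ-zero (λ v → sumFinℤ-zero (antisym v)) ⟩
  0ℤ ∎)
  where
  open ≡-Reasoning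
  S = sumFinℤ (λ v → sumFinℤ (M v))
  double : ∀ x → ℤ.+ 2 * x ≡ x + x
  double = solve-∀

sumSubℤ-cong : {f g : Subset n → ℤ} → (∀ σ → f σ ≡ g σ) → sumSubℤ f ≡ sumSubℤ g
sumSubℤ-cong {zero}  e = e []
sumSubℤ-cong {suc n} e = cong₂ _+_ (sumSubℤ-cong (e ∘ (false ∷_))) (sumSubℤ-cong (e ∘ (true ∷_)))

sumSubℤ-zero : {f : Subset n → ℤ} → (∀ σ → f σ ≡ 0ℤ) → sumSubℤ f ≡ 0ℤ
sumSubℤ-zero {zero}  e = e []
sumSubℤ-zero {suc n} e = cong₂ _+_ (sumSubℤ-zero (e ∘ (false ∷_))) (sumSubℤ-zero (e ∘ (true ∷_)))

sumSubℤ-*ˡ : ∀ x (f : Subset n → ℤ) → sumSubℤ (λ σ → x * f σ) ≡ x * sumSubℤ f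
sumSubℤ-*ˡ {zero}  x f = refl
sumSubℤ-*ˡ {suc n} x f =
  trans (cong₂ _+_ (sumSubℤ-*ˡ x (f ∘ (false ∷_))) (sumSubℤ-*ˡ x (f ∘ (true ∷_))))
        (sym (ℤP.*-distribˡ-+ x _ _))

sumSubℤ-sumFinℤ : (f : Subset n → Fin m → ℤ) →
  sumSubℤ (λ σ → sumFinℤ (f σ)) ≡ sumFinℤ (λ i → sumSubℤ (λ σ → f σ i))
sumSubℤ-sumFinℤ {zero}  f = refl
sumSubℤ-sumFinℤ {suc n} f =
  trans (cong₂ _+_ (sumSubℤ-sumFinℤ (f ∘ (false ∷_))) (sumSubℤ-sumFinℤ (f ∘ (true ∷_))))
        (sym (sumFinℤ-+ (λ i → sumSubℤ (λ σ → f (false ∷ σ) i))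
                        (λ i → sumSubℤ (λ σ → f (true ∷ σ) i))))

sumSubℤ-single : (f : Subset n → ℤ) (τ : Subset n) → (∀ σ → σ ≢ τ → f σ ≡ 0ℤ) → sumSubℤ f ≡ f τ
sumSubℤ-single f [] h = refl
sumSubℤ-single f (false ∷ τ) h =
  trans (cong₂ _+_ (sumSubℤ-single (f ∘ (false ∷_)) τ (λ σ σ≢τ → h _ (σ≢τ ∘ cong tail)))
                   (sumSubℤ-zero (λ σ → h (true ∷ σ) λ ())))
        (ℤP.+-identityʳ _)
sumSubℤ-single f (true ∷ τ) h =
  trans (cong₂ _+_ (sumSubℤ-zero (λ σ → h (false ∷ σ) λ ()))
                   (sumSubℤ-single (f ∘ (true ∷_)) τ (λ σ σ≢τ → h _ (σ≢τ ∘ cong tail))))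
        (ℤP.+-identityˡ _)

sumSubℕ-cong : {f g : Subset n → ℕ} → (∀ σ → f σ ≡ g σ) → sumSubℕ f ≡ sumSubℕ g
sumSubℕ-cong {zero}  e = e []
sumSubℕ-cong {suc n} e = cong₂ ℕ._+_ (sumSubℕ-cong (e ∘ (false ∷_))) (sumSubℕ-cong (e ∘ (true ∷_)))

sumSubℕ-+ : (f g : Subset n → ℕ) → sumSubℕ (λ σ → f σ ℕ.+ g σ) ≡ sumSubℕ f ℕ.+ sumSubℕ g
sumSubℕ-+ {zero}  f g = refl
sumSubℕ-+ {suc n} f g =
  trans (cong₂ ℕ._+_ (sumSubℕ-+ (f ∘ (false ∷_)) (g ∘ (false ∷_)))
                     (sumSubℕ-+ (f ∘ (true ∷_)) (g ∘ (true ∷_))))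
        (ℕ+.interchange (sumSubℕ (f ∘ (false ∷_))) (sumSubℕ (g ∘ (false ∷_)))
                        (sumSubℕ (f ∘ (true ∷_))) (sumSubℕ (g ∘ (true ∷_))))

-- Linear combinations and Steinitz exchange

splitAt-elim : {P : Fin (p ℕ.+ q) → Set} → (∀ i → P (i ↑ˡ q)) → (∀ j → P (p ↑ʳ j)) → ∀ i → P i
splitAt-elim {p} {q} {P} left right i with splitAt p i in eq
... | inj₁ j = subst P (FinP.splitAt⁻¹-↑ˡ eq) (left j)
... | inj₂ j = subst P (FinP.splitAt⁻¹-↑ʳ eq) (right j)

++-all : {A : Set} (Q : A → Set) {f : Fin p → A} {g : Fin q → A} →
  (∀ a → Q (f a)) → (∀ b → Q (g b)) → ∀ i → Q ((f ++ g) i)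
++-all Q {f} {g} hf hg = splitAt-elim
  (λ a → subst Q (sym (VectorP.lookup-++ˡ f g a)) (hf a))
  (λ b → subst Q (sym (VectorP.lookup-++ʳ f g b)) (hg b))

++-injective : {A : Set} {f : Fin p → A} {g : Fin q → A} →
  (∀ a b → f a ≡ f b → a ≡ b) → (∀ a b → g a ≡ g b → a ≡ b) → (∀ a b → f a ≢ g b) →
  ∀ i j → (f ++ g) i ≡ (f ++ g) j → i ≡ j
++-injective {p} {q} {A = A} {f} {g} f-inj g-inj f≢g = splitAt-elim
  (λ a → splitAt-elim (λ b eq → cong (_↑ˡ q) (f-inj a b (via (ˡ a) (ˡ b) eq)))
                      (λ b eq → contradiction (via (ˡ a) (ʳ b) eq) (f≢g a b)))
  (λ a → splitAt-elim (λ b eq → contradiction (via (ˡ b) (ʳ a) (sym eq)) (f≢g b a))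
                      (λ b eq → cong (p ↑ʳ_) (g-inj a b (via (ʳ a) (ʳ b) eq))))
  where
  ˡ = VectorP.lookup-++ˡ f g
  ʳ = VectorP.lookup-++ʳ f g
  via : ∀ {i j} {x y : A} → (f ++ g) i ≡ x → (f ++ g) j ≡ y → (f ++ g) i ≡ (f ++ g) j → x ≡ y
  via lookupᵢ lookupⱼ eq = trans (sym lookupᵢ) (trans eq lookupⱼ)


IsZero : Chain n → Set
IsZero x = ∀ σ → x σ ≡ 0ℤ

lincomb-congʳ : (c : Fin m → ℤ) (z w : Fin m → Chain n) → ∀ σ →
  (∀ a → z a σ ≡ w a σ) → lincomb c z σ ≡ lincomb c w σ
lincomb-congʳ c z w σ z≡w = sumFinℤ-cong (λ a → cong (c a *_) (z≡w a))

lincomb-+ : (c d : Fin m → ℤ) (z : Fin m → Chain n) →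
  lincomb (λ a → c a + d a) z ≗ λ σ → lincomb c z σ + lincomb d z σ
lincomb-+ c d z σ = trans (sumFinℤ-cong (λ a → ℤP.*-distribʳ-+ (z a σ) (c a) (d a)))
                          (sumFinℤ-+ (λ a → c a * z a σ) (λ a → d a * z a σ))

lincomb-*ˡ : ∀ x (c : Fin m → ℤ) (z : Fin m → Chain n) →
  lincomb (λ a → x * c a) z ≗ λ σ → x * lincomb c z σ
lincomb-*ˡ x c z σ = trans (sumFinℤ-cong (λ a → ℤP.*-assoc x (c a) (z a σ)))
                           (sumFinℤ-*ˡ x (λ a → c a * z a σ))

lincomb-neg : (c : Fin m → ℤ) (z : Fin m → Chain n) →
  lincomb (λ a → - c a) z ≗ λ σ → - lincomb c z σ
lincomb-neg c z σ = trans (sumFinℤ-cong (λ a → sym (ℤP.neg-distribˡ-* (c a) (z a σ))))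
                          (sumFinℤ-neg (λ a → c a * z a σ))

+-lincomb-neg : ∀ x (c : Fin m → ℤ) (z : Fin m → Chain n) σ →
  x + lincomb c z σ + lincomb (λ a → - c a) z σ ≡ x
+-lincomb-neg x c z σ = trans (cong (x + lincomb c z σ +_) (lincomb-neg c z σ)) (cancel x _)
  where cancel : ∀ a b → a + b + - b ≡ a
        cancel = solve-∀

+-neg-lincomb : ∀ x (c : Fin m → ℤ) (z : Fin m → Chain n) σ →
  x + lincomb (λ a → - c a) z σ + lincomb c z σ ≡ x
+-neg-lincomb x c z σ = trans (cong (_+ lincomb c z σ) (cong (x +_) (lincomb-neg c z σ))) (cancel x _)
  where cancel : ∀ a b → a + - b + b ≡ a
        cancel = solve-∀

lincomb-zeroˡ : {c : Fin m → ℤ} (z : Fin m → Chain n) → (∀ a → c a ≡ 0ℤ) → IsZero (lincomb c z)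
lincomb-zeroˡ z c≡0 σ = sumFinℤ-zero (λ a → cong (_* z a σ) (c≡0 a))

lincomb-zeroʳ : (c : Fin m → ℤ) (z : Fin m → Chain n) → ∀ σ →
  (∀ a → z a σ ≡ 0ℤ) → lincomb c z σ ≡ 0ℤ
lincomb-zeroʳ c z σ z≡0 = sumFinℤ-zero (λ a → trans (cong (c a *_) (z≡0 a)) (ℤP.*-zeroʳ (c a)))

lincomb-lincomb : (c : Fin p → ℤ) (A : Fin p → Fin m → ℤ) (u : Fin m → Chain n) →
  lincomb c (λ a → lincomb (A a) u) ≗ lincomb (λ j → sumFinℤ (λ a → c a * A a j)) u
lincomb-lincomb c A u σ = begin
  sumFinℤ (λ a → c a * sumFinℤ (λ j → A a j * u j σ))
    ≡⟨ sumFinℤ-cong (λ a → sym (trans (sumFinℤ-cong (λ j → ℤP.*-assoc (c a) (A a j) (u j σ)))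
                                       (sumFinℤ-*ˡ (c a) (λ j → A a j * u j σ)))) ⟩
  sumFinℤ (λ a → sumFinℤ (λ j → c a * A a j * u j σ))
    ≡⟨ sumFinℤ-comm (λ a j → c a * A a j * u j σ) ⟩
  sumFinℤ (λ j → sumFinℤ (λ a → c a * A a j * u j σ))
    ≡⟨ sumFinℤ-cong (λ j → trans (sumFinℤ-cong (λ a → ℤP.*-comm (c a * A a j) (u j σ)))
                         (trans (sumFinℤ-*ˡ (u j σ) (λ a → c a * A a j)) (ℤP.*-comm (u j σ) _))) ⟩
  sumFinℤ (λ j → sumFinℤ (λ a → c a * A a j) * u j σ) ∎
  where open ≡-Reasoning

lincomb-↑ : (c : Fin (p ℕ.+ q) → ℤ) (z : Fin p → Chain n) (w : Fin q → Chain n) →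
  lincomb c (z ++ w) ≗ λ σ → lincomb (c ∘ (_↑ˡ q)) z σ + lincomb (c ∘ (p ↑ʳ_)) w σ
lincomb-↑ {p = p} {q = q} c z w σ = trans (sumFinℤ-↑ {p} {q} _) (cong₂ _+_
  (sumFinℤ-cong (λ a → cong (λ x → c (a ↑ˡ q) * x σ) (VectorP.lookup-++ˡ z w a)))
  (sumFinℤ-cong (λ b → cong (λ x → c (p ↑ʳ b) * x σ) (VectorP.lookup-++ʳ z w b))))

lincomb-++ : (c : Fin p → ℤ) (d : Fin q → ℤ) (z : Fin p → Chain n) (w : Fin q → Chain n) →
  lincomb (c ++ d) (z ++ w) ≗ λ σ → lincomb c z σ + lincomb d w σ
lincomb-++ c d z w σ = trans (lincomb-↑ (c ++ d) z w σ) (cong₂ _+_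
  (sumFinℤ-cong (λ a → cong (_* z a σ) (VectorP.lookup-++ˡ c d a)))
  (sumFinℤ-cong (λ b → cong (_* w b σ) (VectorP.lookup-++ʳ c d b))))

RowsIndependent : (Fin p → Fin m → ℤ) → Set
RowsIndependent {p} A = ∀ (c : Fin p → ℤ) →
  (∀ j → sumFinℤ (λ i → c i * A i j) ≡ 0ℤ) → ∀ i → c i ≡ 0ℤ

rowsIndependent-dropColumn : (A : Fin p → Fin (suc m) → ℤ) → (∀ i → A i zero ≡ 0ℤ) →
  RowsIndependent A → RowsIndependent (λ i j → A i (suc j))
rowsIndependent-dropColumn A col₀≡0 indep c rest = indep c λ where
  zero    → sumFinℤ-zero (λ i → trans (cong (c i *_) (col₀≡0 i)) (ℤP.*-zeroʳ (c i)))
  (suc j) → rest j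

sumFinℤ-insertAt : (x : Fin m → ℤ) (i₀ : Fin (suc m)) (s : ℤ) (f : Fin (suc m) → ℤ) →
  sumFinℤ (λ i → insertAt x i₀ s i * f i) ≡ s * f i₀ + sumFinℤ (λ l → x l * f (punchIn i₀ l))
sumFinℤ-insertAt x i₀ s f = trans (sumFinℤ-punchIn (λ i → insertAt x i₀ s i * f i) i₀)
  (cong₂ _+_ (cong (_* f i₀) (VectorP.insertAt-lookup x i₀ s))
             (sumFinℤ-cong (λ l → cong (_* f (punchIn i₀ l)) (VectorP.insertAt-punchIn x i₀ s l))))

-- Clear the first column with the pivot row i₀, then drop that row and column.
eliminate : (A : Fin (suc p) → Fin (suc m) → ℤ) → Fin (suc p) → Fin p → Fin m → ℤ
eliminate A i₀ l j = A i₀ zero * A (punchIn i₀ l) (suc j) - A i₀ (suc j) * A (punchIn i₀ l) zero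

rowsIndependent-eliminate : (A : Fin (suc p) → Fin (suc m) → ℤ) (i₀ : Fin (suc p)) →
  A i₀ zero ≢ 0ℤ → RowsIndependent A → RowsIndependent (eliminate A i₀)
rowsIndependent-eliminate {m = m} A i₀ α≢0 indep c′ eqs l =
  *-cancelˡ-≡0 α≢0 (trans (sym (VectorP.insertAt-punchIn αc′ i₀ (- S zero) l))
                          (indep c eqsA (punchIn i₀ l)))
  where
  α = A i₀ zero
  αc′ = λ l → α * c′ l
  S : Fin (suc m) → ℤ
  S j = sumFinℤ (λ l → c′ l * A (punchIn i₀ l) j)
  c = insertAt αc′ i₀ (- S zero)
  expand : ∀ j → sumFinℤ (λ i → c i * A i j) ≡ - S zero * A i₀ j + α * S j
  expand j = trans (sumFinℤ-insertAt αc′ i₀ (- S zero) (λ i → A i j))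
    (cong (- S zero * A i₀ j +_) (trans (sumFinℤ-cong (λ l → ℤP.*-assoc α (c′ l) _))
                                        (sumFinℤ-*ˡ α (λ l → c′ l * A (punchIn i₀ l) j))))
  eqsA : ∀ j → sumFinℤ (λ i → c i * A i j) ≡ 0ℤ
  eqsA zero    = trans (expand zero) (cancel (S zero) α)
    where cancel : ∀ s a → - s * a + a * s ≡ 0ℤ
          cancel = solve-∀
  eqsA (suc j) = begin
    sumFinℤ (λ i → c i * A i (suc j))
      ≡⟨ expand (suc j) ⟩
    - S zero * A i₀ (suc j) + α * S (suc j)
      ≡⟨ reorder (S zero) (A i₀ (suc j)) α (S (suc j)) ⟩
    α * S (suc j) - A i₀ (suc j) * S zero
      ≡⟨ sym (sumFinℤ-linear α (A i₀ (suc j)) (λ l → c′ l * A (punchIn i₀ l) (suc j))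
                                              (λ l → c′ l * A (punchIn i₀ l) zero)) ⟩
    sumFinℤ (λ l → α * (c′ l * A (punchIn i₀ l) (suc j)) - A i₀ (suc j) * (c′ l * A (punchIn i₀ l) zero))
      ≡⟨ sumFinℤ-cong (λ l → distribute (c′ l) α _ (A i₀ (suc j)) _) ⟩
    sumFinℤ (λ l → c′ l * eliminate A i₀ l j)
      ≡⟨ eqs j ⟩
    0ℤ ∎
    where
    open ≡-Reasoning
    reorder : ∀ s b a t → - s * b + a * t ≡ a * t - b * s
    reorder = solve-∀
    distribute : ∀ x a y b z → a * (x * y) - b * (x * z) ≡ x * (a * y - b * z)
    distribute = solve-∀

rows-dependent : m < p → (A : Fin p → Fin m → ℤ) → ¬ RowsIndependent A
rows-dependent {zero} {suc p} _ A indep with indep (λ _ → 1ℤ) (λ ()) zero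
... | ()
rows-dependent {suc m} {suc p} (s≤s m<p) A indep
  with FinP.all? (λ i → A i zero ℤ.≟ 0ℤ)
... | yes col₀≡0 = rows-dependent (ℕP.m<n⇒m<1+n m<p) (λ i j → A i (suc j))
                     (rowsIndependent-dropColumn A col₀≡0 indep)
... | no col₀≢0 with FinP.¬∀⟶∃¬ _ _ (λ i → A i zero ℤ.≟ 0ℤ) col₀≢0
...   | i₀ , α≢0 = rows-dependent m<p (eliminate A i₀) (rowsIndependent-eliminate A i₀ α≢0 indep)

rowsIndependent⇒≤ : (A : Fin p → Fin m → ℤ) → RowsIndependent A → p ≤ m
rowsIndependent⇒≤ {p} {m} A indep with p ℕP.≤? m
... | yes p≤m = p≤m
... | no p≰m  = contradiction indep (rows-dependent (ℕP.≰⇒> p≰m) A)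


-- Rational spans and maximal independent families

IndependentModulo : (Chain n → Set) → (Fin m → Chain n) → Set
IndependentModulo {m = m} Null z = ∀ (c : Fin m → ℤ) → Null (lincomb c z) → ∀ a → c a ≡ 0ℤ

Independent : (Fin m → Chain n) → Set
Independent = IndependentModulo IsZero

independent⇒≤ : {v : Fin p → Chain n} (u : Fin m → Chain n) (A : Fin p → Fin m → ℤ) →
  Independent v → (∀ a → v a ≗ lincomb (A a) u) → p ≤ m
independent⇒≤ {v = v} u A indep v≗Au = rowsIndependent⇒≤ A λ c relation → indep c λ σ →
  trans (lincomb-congʳ c v (λ a → lincomb (A a) u) σ (λ a → v≗Au a σ))
        (trans (lincomb-lincomb c A u σ) (lincomb-zeroˡ u relation σ))

-- y lies in the rational span of g: a nonzero multiple of y is an integral combination of g.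
RatCombination : (Fin q → Chain n) → Chain n → Set
RatCombination {q = q} g y =
  Σ ℤ λ l → l ≢ 0ℤ × Σ (Fin q → ℤ) λ e → (λ σ → l * y σ) ≗ lincomb e g

InRatSpan : (Fin q → Chain n) → Chain n → Set
InRatSpan g y = ¬ ¬ RatCombination g y

module _ {g : Fin q → Chain n} where

  inRatSpan-cong : {x y : Chain n} → x ≗ y → InRatSpan g x → InRatSpan g y
  inRatSpan-cong x≗y = _<$>_ λ (l , l≢0 , e , lx≗eg) →
    l , l≢0 , e , λ σ → trans (cong (l *_) (sym (x≗y σ))) (lx≗eg σ)

  inRatSpan-zero : InRatSpan g (λ _ → 0ℤ)
  inRatSpan-zero = pure (1ℤ , (λ ()) , (λ _ → 0ℤ) , λ σ → sym (lincomb-zeroˡ g (λ _ → refl) σ))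

  inRatSpan-*ˡ : ∀ k {y} → InRatSpan g y → InRatSpan g (λ σ → k * y σ)
  inRatSpan-*ˡ k {y} = _<$>_ λ (l , l≢0 , e , ly≗eg) → l , l≢0 , (λ a → k * e a) , λ σ →
    trans (ℤ*.x∙yz≈y∙xz l k (y σ)) (trans (cong (k *_) (ly≗eg σ)) (sym (lincomb-*ˡ k e g σ)))

  inRatSpan-+ : ∀ {x y} → InRatSpan g x → InRatSpan g y → InRatSpan g (λ σ → x σ + y σ)
  inRatSpan-+ {x} {y} x∈ y∈ = do
    (l₁ , l₁≢0 , e₁ , l₁x≗) ← x∈
    (l₂ , l₂≢0 , e₂ , l₂y≗) ← y∈
    pure (l₁ * l₂ , *-≢0 l₁≢0 l₂≢0 , (λ a → l₂ * e₁ a + l₁ * e₂ a) , λ σ → begin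
      l₁ * l₂ * (x σ + y σ)
        ≡⟨ distribute l₁ l₂ (x σ) (y σ) ⟩
      l₂ * (l₁ * x σ) + l₁ * (l₂ * y σ)
        ≡⟨ cong₂ _+_ (cong (l₂ *_) (l₁x≗ σ)) (cong (l₁ *_) (l₂y≗ σ)) ⟩
      l₂ * lincomb e₁ g σ + l₁ * lincomb e₂ g σ
        ≡⟨ sym (cong₂ _+_ (lincomb-*ˡ l₂ e₁ g σ) (lincomb-*ˡ l₁ e₂ g σ)) ⟩
      lincomb (λ a → l₂ * e₁ a) g σ + lincomb (λ a → l₁ * e₂ a) g σ
        ≡⟨ sym (lincomb-+ (λ a → l₂ * e₁ a) (λ a → l₁ * e₂ a) g σ) ⟩
      lincomb (λ a → l₂ * e₁ a + l₁ * e₂ a) g σ ∎)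
    where
    open ≡-Reasoning
    distribute : ∀ l₁ l₂ x y → l₁ * l₂ * (x + y) ≡ l₂ * (l₁ * x) + l₁ * (l₂ * y)
    distribute = solve-∀

  inRatSpan-lincomb : (c : Fin p → ℤ) {h : Fin p → Chain n} →
    (∀ a → InRatSpan g (h a)) → InRatSpan g (lincomb c h)
  inRatSpan-lincomb {p = zero}  c h∈ = inRatSpan-zero
  inRatSpan-lincomb {p = suc p} c h∈ =
    inRatSpan-+ (inRatSpan-*ˡ (c zero) (h∈ zero)) (inRatSpan-lincomb (c ∘ suc) (h∈ ∘ suc))

  inRatSpan-cancel : ∀ {k y} → k ≢ 0ℤ → InRatSpan g (λ σ → k * y σ) → InRatSpan g y
  inRatSpan-cancel {k} {y} k≢0 = _<$>_ λ (l , l≢0 , e , lky≗eg) →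
    l * k , *-≢0 l≢0 k≢0 , e , λ σ → trans (ℤP.*-assoc l k (y σ)) (lky≗eg σ)

dependence⇒inRatSpan : {g : Fin q → Chain n} {y : Chain n} {l : ℤ} (c : Fin q → ℤ) → l ≢ 0ℤ →
  (∀ σ → l * y σ + lincomb c g σ ≡ 0ℤ) → InRatSpan g y
dependence⇒inRatSpan {g = g} c l≢0 dep = pure (_ , l≢0 , (λ a → - c a) , λ σ →
  trans (inverseˡ-unique _ _ (dep σ)) (sym (lincomb-neg c g σ)))

++-independent : {f : Fin p → Chain n} {g : Fin q → Chain n} →
  (∀ c d → (∀ σ → lincomb c f σ + lincomb d g σ ≡ 0ℤ) → (∀ a → c a ≡ 0ℤ) × (∀ b → d b ≡ 0ℤ)) →
  Independent (f ++ g)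
++-independent {p = p} {q = q} {f = f} {g} split c fg≡0 = splitAt-elim (proj₁ both) (proj₂ both)
  where both = split (c ∘ (_↑ˡ q)) (c ∘ (p ↑ʳ_)) (λ σ → trans (sym (lincomb-↑ c f g σ)) (fg≡0 σ))

lincomb-inRatSpan : (g : Fin q → Chain n) (e : Fin q → ℤ) → InRatSpan g (lincomb e g)
lincomb-inRatSpan g e = pure (1ℤ , (λ ()) , e , λ σ → ℤP.*-identityˡ _)

inRatSpan-++ˡ : {g : Fin p → Chain n} {h : Fin q → Chain n} {y : Chain n} →
  InRatSpan g y → InRatSpan (g ++ h) y
inRatSpan-++ˡ {g = g} {h} = _<$>_ λ (l , l≢0 , e , ly≗eg) → l , l≢0 , e ++ (λ _ → 0ℤ) , λ σ →
  trans (ly≗eg σ) (sym (trans (lincomb-++ e (λ _ → 0ℤ) g h σ)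
    (trans (cong (lincomb e g σ +_) (lincomb-zeroˡ h (λ _ → refl) σ)) (ℤP.+-identityʳ _))))

inRatSpan-++ʳ : {g : Fin p → Chain n} {h : Fin q → Chain n} {y : Chain n} →
  InRatSpan h y → InRatSpan (g ++ h) y
inRatSpan-++ʳ {g = g} {h} = _<$>_ λ (l , l≢0 , e , ly≗eh) → l , l≢0 , (λ _ → 0ℤ) ++ e , λ σ →
  trans (ly≗eh σ) (sym (trans (lincomb-++ (λ _ → 0ℤ) e g h σ)
    (trans (cong (_+ lincomb e h σ) (lincomb-zeroˡ g (λ _ → refl) σ)) (ℤP.+-identityˡ _))))

independent-ratCombinations⇒≤ : {v : Fin p → Chain n} (u : Fin m → Chain n) →
  Independent v → (∀ a → RatCombination u (v a)) → p ≤ m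
independent-ratCombinations⇒≤ {v = v} u indep combination =
  independent⇒≤ {v = λ a σ → l a * v a σ} u e scaled-independent lv≗eu
  where
  l = λ a → proj₁ (combination a)
  e = λ a → proj₁ (proj₂ (proj₂ (combination a)))
  lv≗eu = λ a → proj₂ (proj₂ (proj₂ (combination a)))
  scaled-independent : Independent (λ a σ → l a * v a σ)
  scaled-independent c relation a = *-cancelˡ-≡0 (proj₁ (proj₂ (combination a)))
    (trans (ℤP.*-comm (l a) (c a)) (indep (λ b → c b * l b)
      (λ σ → trans (sumFinℤ-cong (λ b → ℤP.*-assoc (c b) (l b) (v b σ))) (relation σ)) a))

independent-inRatSpan⇒≤ : {v : Fin p → Chain n} (u : Fin m → Chain n) →
  Independent v → (∀ a → InRatSpan u (v a)) → ¬ ¬ (p ≤ m)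
independent-inRatSpan⇒≤ u indep v∈ =
  independent-ratCombinations⇒≤ u indep <$> FinP.sequence rawApplicative v∈

dependence : {Null : Chain n → Set} {z : Fin m → Chain n} → ¬ IndependentModulo Null z →
  ¬ ¬ (Σ (Fin m → ℤ) λ c → Null (lincomb c z) × ∃ λ a → c a ≢ 0ℤ)
dependence ¬indep ¬dep = ¬indep λ c null a →
  decidable-stable (c a ℤ.≟ 0ℤ) (λ ca≢0 → ¬dep (c , null , a , ca≢0))

isMax-exists : (P : ℕ → Set) → ∀ B → (∀ m → P m → m ≤ B) → P 0 → ¬ ¬ ∃ (IsMax P)
isMax-exists P zero    bound P0 = pure (0 , P0 , bound)
isMax-exists P (suc B) bound P0 = do
  yes PB ← ¬¬-excluded-middle
    where no ¬PB → isMax-exists P B (λ m Pm → ℕP.≤-pred (ℕP.≤∧≢⇒< (bound m Pm) λ { refl → ¬PB Pm }))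
                                   P0
  pure (suc B , PB , bound)

IsMax-transport : {P Q : ℕ → Set} {b : ℕ} →
  (∀ m → P m → Q m) → (∀ m → Q m → P m) → IsMax P b → IsMax Q b
IsMax-transport P⇒Q Q⇒P (Pb , maximal) = P⇒Q _ Pb , λ m Qm → maximal m (Q⇒P m Qm)

module _ {n : ℕ} {A : Set} (φ : A → Chain n) (Mem : A → Set) (Null : Chain n → Set) where

  IndependentFamily : ℕ → Set
  IndependentFamily m = Σ (Fin m → A) λ x → (∀ a → Mem (x a)) × IndependentModulo Null (φ ∘ x)

  maximal-dependence : (∀ {x y} → x ≗ y → Null x → Null y) →
    {b : ℕ} (max : IsMax IndependentFamily b) → ∀ {x} → Mem x →
    ¬ ¬ (Σ ℤ λ l → l ≢ 0ℤ × Σ (Fin b → ℤ) λ c →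
           Null (λ σ → l * φ x σ + lincomb c (φ ∘ proj₁ (proj₁ max)) σ))
  maximal-dependence Null-resp {b} ((z , z∈ , indep) , maximal) {x} x∈ = do
    (c , null , a , ca≢0) ← dependence {Null = Null} {z = φ ∘ (x Vector.∷ z)} extended-dependent
    no c₀≢0 ← pure (c zero ℤ.≟ 0ℤ)
      where yes c₀≡0 → contradiction (tail-zero c null c₀≡0 a) ca≢0
    pure (c zero , c₀≢0 , c ∘ suc , null)
    where
    extended-dependent : ¬ IndependentModulo Null (φ ∘ (x Vector.∷ z))
    extended-dependent indep′ =
      ℕP.n≮n b (maximal (suc b) (x Vector.∷ z , (λ { zero → x∈ ; (suc a) → z∈ a }) , indep′))
    tail-zero : ∀ c → Null (lincomb c (φ ∘ (x Vector.∷ z))) → c zero ≡ 0ℤ → ∀ a → c a ≡ 0ℤ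
    tail-zero c null c₀≡0 zero    = c₀≡0
    tail-zero c null c₀≡0 (suc a) = indep (c ∘ suc) (Null-resp drop-head null) a
      where
      drop-head : (λ σ → c zero * φ x σ + lincomb (c ∘ suc) (φ ∘ z) σ) ≗ lincomb (c ∘ suc) (φ ∘ z)
      drop-head σ = trans (cong (λ c₀ → c₀ * φ x σ + lincomb (c ∘ suc) (φ ∘ z) σ) c₀≡0) (ℤP.+-identityˡ _)

-- Relative boundaries and ∂∂ = 0

if-true : {A : Set} {b : Bool} {x y : A} → b ≡ true → (if b then x else y) ≡ x
if-true refl = refl

if-false : {A : Set} {b : Bool} {x y : A} → b ≡ false → (if b then x else y) ≡ y
if-false refl = refl

if-zero : ∀ b {x : ℤ} → x ≡ 0ℤ → (if b then x else 0ℤ) ≡ 0ℤ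
if-zero true  x≡0 = x≡0
if-zero false _   = refl

unit-self : (σ : Subset n) → unit σ σ ≡ 1ℤ
unit-self σ with ≡-dec BoolP._≟_ σ σ
... | yes _   = refl
... | no σ≢σ = contradiction refl σ≢σ

unit-≢ : {σ τ : Subset n} → σ ≢ τ → unit σ τ ≡ 0ℤ
unit-≢ {σ = σ} {τ} σ≢τ with ≡-dec BoolP._≟_ σ τ
... | yes σ≡τ = contradiction σ≡τ σ≢τ
... | no _    = refl

SupportedOn : (Subset n → Bool) → Chain n → Set
SupportedOn T x = ∀ σ → T σ ≡ false → x σ ≡ 0ℤ

unit-supportedOn : (T : Subset n → Bool) {τ : Subset n} → T τ ≡ true → SupportedOn T (unit τ)
unit-supportedOn T Tτ σ Tσ = unit-≢ λ { refl → contradiction (trans (sym Tτ) Tσ) λ () }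

lincomb-supportedOn : (T : Subset n → Bool) (c : Fin m → ℤ) {z : Fin m → Chain n} →
  (∀ a → SupportedOn T (z a)) → SupportedOn T (lincomb c z)
lincomb-supportedOn T c {z} z-supp σ Tσ = lincomb-zeroʳ c z σ (λ a → z-supp a σ Tσ)

module _ (X Y : Family n) where

  rel-true⁻ : ∀ {s σ} → rel X Y s σ ≡ true → X σ ≡ true × Y σ ≡ false × ∣ σ ∣ ≡ s
  rel-true⁻ {s} {σ} relσ with X σ | Y σ | ∣ σ ∣ ≡ᵇ s in eq
  ... | true | false | true = refl , refl , ℕP.≡ᵇ⇒≡ _ _ (subst T (sym eq) tt)

  rel-true⁺ : ∀ {s σ} → X σ ≡ true → Y σ ≡ false → ∣ σ ∣ ≡ s → rel X Y s σ ≡ true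
  rel-true⁺ {s} Xσ Yσ refl rewrite Xσ | Yσ = Equivalence.to BoolP.T-≡ (ℕP.≡⇒≡ᵇ s s refl)

  bd-supportedOn : ∀ r (d : Chain n) → SupportedOn (rel X Y r) (bd X Y r d)
  bd-supportedOn r d σ = if-false

  bd-cong : ∀ r {d d′ : Chain n} → d ≗ d′ → bd X Y r d ≗ bd X Y r d′
  bd-cong r {d} {d′} d≗d′ σ with rel X Y r σ
  ... | false = refl
  ... | true  = sumSubℤ-cong λ τ →
    cong (λ x → incidence σ τ * (if rel X Y (suc r) τ then x else 0ℤ)) (d≗d′ τ)

  bd-zero : ∀ r {d : Chain n} → IsZero d → IsZero (bd X Y r d)
  bd-zero r {d} d≡0 σ with rel X Y r σ
  ... | false = refl
  ... | true  = sumSubℤ-zero λ τ →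
    trans (cong (incidence σ τ *_) (if-zero (rel X Y (suc r) τ) (d≡0 τ))) (ℤP.*-zeroʳ (incidence σ τ))

  bd-lincomb : ∀ r (c : Fin m → ℤ) (z : Fin m → Chain n) →
    bd X Y r (lincomb c z) ≗ lincomb c (λ a → bd X Y r (z a))
  bd-lincomb r c z σ with rel X Y r σ
  ... | false = sym (lincomb-zeroʳ c (λ _ _ → 0ℤ) σ λ _ → refl)
  ... | true  = begin
    sumSubℤ (λ τ → incidence σ τ * masked τ (lincomb c z τ))
      ≡⟨ sumSubℤ-cong (λ τ → cong (incidence σ τ *_) (masked-lincomb τ)) ⟩
    sumSubℤ (λ τ → incidence σ τ * sumFinℤ (λ a → c a * masked τ (z a τ)))
      ≡⟨ sumSubℤ-cong (λ τ → trans (sym (sumFinℤ-*ˡ (incidence σ τ) (λ a → c a * masked τ (z a τ))))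
                                   (sumFinℤ-cong (λ a → ℤ*.x∙yz≈y∙xz (incidence σ τ) (c a) _))) ⟩
    sumSubℤ (λ τ → sumFinℤ (λ a → c a * (incidence σ τ * masked τ (z a τ))))
      ≡⟨ sumSubℤ-sumFinℤ (λ τ a → c a * (incidence σ τ * masked τ (z a τ))) ⟩
    sumFinℤ (λ a → sumSubℤ (λ τ → c a * (incidence σ τ * masked τ (z a τ))))
      ≡⟨ sumFinℤ-cong (λ a → sumSubℤ-*ˡ (c a) (λ τ → incidence σ τ * masked τ (z a τ))) ⟩
    sumFinℤ (λ a → c a * sumSubℤ (λ τ → incidence σ τ * masked τ (z a τ))) ∎
    where
    open ≡-Reasoning
    masked : Subset n → ℤ → ℤ
    masked τ x = if rel X Y (suc r) τ then x else 0ℤ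
    masked-lincomb : ∀ τ → masked τ (lincomb c z τ) ≡ sumFinℤ (λ a → c a * masked τ (z a τ))
    masked-lincomb τ with rel X Y (suc r) τ
    ... | true  = refl
    ... | false = sym (lincomb-zeroʳ c (λ _ _ → 0ℤ) τ λ _ → refl)

sign-suc : ∀ l → sign (suc l) ≡ - sign l
sign-suc zero          = refl
sign-suc (suc zero)    = refl
sign-suc (suc (suc l)) = sign-suc l

below-∈ : {u v : Fin n} → toℕ u < toℕ v → u ∈ below v
below-∈ {u = u} {v} u<v = VecP.lookup⇒[]= u (below v)
  (trans (VecP.lookup∘tabulate (λ u → toℕ u <ᵇ toℕ v) u) (Equivalence.to BoolP.T-≡ (ℕP.<⇒<ᵇ u<v)))

below-∉ : {u v : Fin n} → toℕ v ≤ toℕ u → u ∉ below v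
below-∉ {u = u} {v} v≤u u∈ = ℕP.<⇒≱ (ℕP.<ᵇ⇒< (toℕ u) (toℕ v) (Equivalence.from BoolP.T-≡
  (trans (sym (VecP.lookup∘tabulate (λ u → toℕ u <ᵇ toℕ v) u)) (VecP.[]=⇒lookup u∈)))) v≤u

∣∪⁅⁆∩∣-∉ : (p q : Subset n) {x : Fin n} → x ∉ q → ∣ (p ∪ ⁅ x ⁆) ∩ q ∣ ≡ ∣ p ∩ q ∣
∣∪⁅⁆∩∣-∉ (_     ∷ p) (true  ∷ q) {zero} x∉q = contradiction here x∉q
∣∪⁅⁆∩∣-∉ (false ∷ p) (false ∷ q) {zero} _   = cong (λ s → ∣ s ∩ q ∣) (SubsetP.∪-identityʳ p)
∣∪⁅⁆∩∣-∉ (true  ∷ p) (false ∷ q) {zero} _   = cong (λ s → ∣ s ∩ q ∣) (SubsetP.∪-identityʳ p)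
∣∪⁅⁆∩∣-∉ (false ∷ p) (false ∷ q) {suc x} x∉q = ∣∪⁅⁆∩∣-∉ p q (x∉q ∘ there)
∣∪⁅⁆∩∣-∉ (false ∷ p) (true  ∷ q) {suc x} x∉q = ∣∪⁅⁆∩∣-∉ p q (x∉q ∘ there)
∣∪⁅⁆∩∣-∉ (true  ∷ p) (false ∷ q) {suc x} x∉q = ∣∪⁅⁆∩∣-∉ p q (x∉q ∘ there)
∣∪⁅⁆∩∣-∉ (true  ∷ p) (true  ∷ q) {suc x} x∉q = cong suc (∣∪⁅⁆∩∣-∉ p q (x∉q ∘ there))

∣∪⁅⁆∩∣-∈ : (p q : Subset n) {x : Fin n} → x ∉ p → x ∈ q → ∣ (p ∪ ⁅ x ⁆) ∩ q ∣ ≡ suc ∣ p ∩ q ∣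
∣∪⁅⁆∩∣-∈ (true  ∷ p) _           {zero} x∉p _ = contradiction here x∉p
∣∪⁅⁆∩∣-∈ (false ∷ p) (true ∷ q)  {zero} _   _ = cong (λ s → suc ∣ s ∩ q ∣) (SubsetP.∪-identityʳ p)
∣∪⁅⁆∩∣-∈ (false ∷ p) (_    ∷ q)  {suc x} x∉p (there x∈q) = ∣∪⁅⁆∩∣-∈ p q (x∉p ∘ there) x∈q
∣∪⁅⁆∩∣-∈ (true  ∷ p) (false ∷ q) {suc x} x∉p (there x∈q) = ∣∪⁅⁆∩∣-∈ p q (x∉p ∘ there) x∈q
∣∪⁅⁆∩∣-∈ (true  ∷ p) (true  ∷ q) {suc x} x∉p (there x∈q) = cong suc (∣∪⁅⁆∩∣-∈ p q (x∉p ∘ there) x∈q)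

∣∪⁅⁆∣ : (p : Subset n) {x : Fin n} → x ∉ p → ∣ p ∪ ⁅ x ⁆ ∣ ≡ suc ∣ p ∣
∣∪⁅⁆∣ p {x} x∉p = begin
  ∣ p ∪ ⁅ x ⁆ ∣       ≡⟨ cong ∣_∣ (sym (SubsetP.∩-identityʳ (p ∪ ⁅ x ⁆))) ⟩
  ∣ (p ∪ ⁅ x ⁆) ∩ ⊤ ∣ ≡⟨ ∣∪⁅⁆∩∣-∈ p ⊤ x∉p SubsetP.∈⊤ ⟩
  suc ∣ p ∩ ⊤ ∣       ≡⟨ cong (suc ∘ ∣_∣) (SubsetP.∩-identityʳ p) ⟩
  suc ∣ p ∣           ∎
  where open ≡-Reasoning

incidenceTerm : Subset n → Subset n → Fin n → ℤ
incidenceTerm σ τ v with v ∈? σ | ≡-dec BoolP._≟_ τ (σ ∪ ⁅ v ⁆)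
... | no _ | yes _ = sign ∣ τ ∩ below v ∣
... | _    | _     = 0ℤ

-- The summand of `incidence` is local to its definition, so `incidence-summand` leaves it to
-- unification with its use in `incidence-sum`, which is checked first.
mutual
  incidence-sum : (σ τ : Subset n) → incidence σ τ ≡ sumFinℤ (incidenceTerm σ τ)
  incidence-sum σ τ = sumFinℤ-cong (incidence-summand σ τ)

  incidence-summand : (σ τ : Subset n) (v : Fin n) → _ ≡ incidenceTerm σ τ v
  incidence-summand σ τ v with v ∈? σ | ≡-dec BoolP._≟_ τ (σ ∪ ⁅ v ⁆)
  ... | no _  | yes _ = refl
  ... | no _  | no _  = refl
  ... | yes _ | _     = refl

incidenceTerm-∈ : ∀ σ τ {v : Fin n} → v ∈ σ → incidenceTerm σ τ v ≡ 0ℤ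
incidenceTerm-∈ σ τ {v} v∈σ with v ∈? σ | ≡-dec BoolP._≟_ τ (σ ∪ ⁅ v ⁆)
... | yes _   | _     = refl
... | no v∉σ | _     = contradiction v∈σ v∉σ

incidenceTerm-≢ : ∀ σ τ {v : Fin n} → τ ≢ σ ∪ ⁅ v ⁆ → incidenceTerm σ τ v ≡ 0ℤ
incidenceTerm-≢ σ τ {v} τ≢ with v ∈? σ | ≡-dec BoolP._≟_ τ (σ ∪ ⁅ v ⁆)
... | yes _ | _     = refl
... | no _  | no _  = refl
... | no _  | yes τ≡ = contradiction τ≡ τ≢

incidenceTerm-∪ : ∀ σ {v : Fin n} → v ∉ σ → incidenceTerm σ (σ ∪ ⁅ v ⁆) v ≡ sign ∣ (σ ∪ ⁅ v ⁆) ∩ below v ∣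
incidenceTerm-∪ σ {v} v∉σ with v ∈? σ | ≡-dec BoolP._≟_ (σ ∪ ⁅ v ⁆) (σ ∪ ⁅ v ⁆)
... | yes v∈σ | _    = contradiction v∈σ v∉σ
... | no _    | yes _ = refl
... | no _    | no ≢ = contradiction refl ≢

incidence-≢0 : (σ τ : Subset n) → incidence σ τ ≢ 0ℤ → ∃ λ v → v ∉ σ × τ ≡ σ ∪ ⁅ v ⁆
incidence-≢0 σ τ inc≢0
  with FinP.any? (λ v → ¬? (v ∈? σ) ×-dec ≡-dec BoolP._≟_ τ (σ ∪ ⁅ v ⁆))
... | yes found = found
... | no none   = contradiction (trans (incidence-sum σ τ) (sumFinℤ-zero vanishing)) inc≢0
  where
  vanishing : ∀ v → incidenceTerm σ τ v ≡ 0ℤ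
  vanishing v with v ∈? σ | ≡-dec BoolP._≟_ τ (σ ∪ ⁅ v ⁆)
  ... | yes _   | _      = refl
  ... | no _    | no _   = refl
  ... | no v∉σ | yes τ≡ = contradiction (v , v∉σ , τ≡) none

-- path v w is the contribution of the face ρ ∪ {v} to (∂∂σ)(ρ): remove w from σ, then v.
-- Removing the two vertices in the other order contributes the opposite sign.
module ∂∂ (ρ σ : Subset n) where

  _+ρ : Fin n → Subset n
  v +ρ = ρ ∪ ⁅ v ⁆

  path : Fin n → Fin n → ℤ
  path v w = incidenceTerm ρ (v +ρ) v * incidenceTerm (v +ρ) σ w

  ∈-+ρ : ∀ v {u} → u ∈ ρ → u ∈ v +ρ
  ∈-+ρ v = SubsetP.p⊆p∪q ⁅ v ⁆

  v∈v+ρ : ∀ v → v ∈ v +ρ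
  v∈v+ρ v = SubsetP.q⊆p∪q ρ ⁅ v ⁆ (SubsetP.x∈⁅x⁆ v)

  ∉-+ρ : ∀ {v u} → u ∉ ρ → u ≢ v → u ∉ v +ρ
  ∉-+ρ {v} {u} u∉ρ u≢v u∈ with SubsetP.x∈p∪q⁻ ρ ⁅ v ⁆ u∈
  ... | inj₁ u∈ρ  = u∉ρ u∈ρ
  ... | inj₂ u∈⁅v⁆ = u≢v (SubsetP.x∈⁅y⁆⇒x≡y v u∈⁅v⁆)

  +ρ-comm : ∀ v w → v +ρ ∪ ⁅ w ⁆ ≡ w +ρ ∪ ⁅ v ⁆
  +ρ-comm v w = trans (SubsetP.∪-assoc ρ ⁅ v ⁆ ⁅ w ⁆)
    (trans (cong (ρ ∪_) (SubsetP.∪-comm ⁅ v ⁆ ⁅ w ⁆)) (sym (SubsetP.∪-assoc ρ ⁅ w ⁆ ⁅ v ⁆)))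

  path-∈ : ∀ {v} w → v ∈ ρ → path v w ≡ 0ℤ
  path-∈ {v} w v∈ρ = cong (_* incidenceTerm (v +ρ) σ w) (incidenceTerm-∈ ρ (v +ρ) v∈ρ)

  path-∈+ρ : ∀ v {w} → w ∈ v +ρ → path v w ≡ 0ℤ
  path-∈+ρ v w∈ = trans (cong (incidenceTerm ρ (v +ρ) v *_) (incidenceTerm-∈ (v +ρ) σ w∈))
                        (ℤP.*-zeroʳ (incidenceTerm ρ (v +ρ) v))

  path-≢ : ∀ v w → σ ≢ v +ρ ∪ ⁅ w ⁆ → path v w ≡ 0ℤ
  path-≢ v w σ≢ = trans (cong (incidenceTerm ρ (v +ρ) v *_) (incidenceTerm-≢ (v +ρ) σ σ≢))
                        (ℤP.*-zeroʳ (incidenceTerm ρ (v +ρ) v))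

  path-cancel : ∀ {v w} → v ∉ ρ → w ∉ ρ → toℕ v < toℕ w → σ ≡ v +ρ ∪ ⁅ w ⁆ → path v w + path w v ≡ 0ℤ
  path-cancel {v} {w} v∉ρ w∉ρ v<w refl = begin
    path v w + path w v
      ≡⟨ cong₂ _+_ (cong₂ _*_ (incidenceTerm-∪ ρ v∉ρ) (incidenceTerm-∪ (v +ρ) w∉v+ρ))
                   (cong₂ _*_ (incidenceTerm-∪ ρ w∉ρ) (trans (cong (λ τ → incidenceTerm (w +ρ) τ v) (+ρ-comm v w))
                                                             (incidenceTerm-∪ (w +ρ) v∉w+ρ))) ⟩
    sign ∣ v +ρ ∩ below v ∣ * sign ∣ (v +ρ ∪ ⁅ w ⁆) ∩ below w ∣ +
    sign ∣ w +ρ ∩ below w ∣ * sign ∣ (w +ρ ∪ ⁅ v ⁆) ∩ below v ∣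
      ≡⟨ cong₂ _+_ (cong₂ _*_ (cong sign (∣∪⁅⁆∩∣-∉ ρ (below v) v∉below-v))
                              (cong sign (trans (∣∪⁅⁆∩∣-∉ (v +ρ) (below w) w∉below-w)
                                                (∣∪⁅⁆∩∣-∈ ρ (below w) v∉ρ (below-∈ v<w)))))
                   (cong₂ _*_ (cong sign (∣∪⁅⁆∩∣-∉ ρ (below w) w∉below-w))
                              (cong sign (trans (∣∪⁅⁆∩∣-∉ (w +ρ) (below v) v∉below-v)
                                                (∣∪⁅⁆∩∣-∉ ρ (below v) (below-∉ (ℕP.<⇒≤ v<w)))))) ⟩
    sign A * sign (suc B) + sign B * sign A
      ≡⟨ cong (λ s → sign A * s + sign B * sign A) (sign-suc B) ⟩
    sign A * - sign B + sign B * sign A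
      ≡⟨ cancel (sign A) (sign B) ⟩
    0ℤ ∎
    where
    open ≡-Reasoning
    A = ∣ ρ ∩ below v ∣
    B = ∣ ρ ∩ below w ∣
    v∉below-v = below-∉ {u = v} ℕP.≤-refl
    w∉below-w = below-∉ {u = w} ℕP.≤-refl
    w∉v+ρ = ∉-+ρ w∉ρ (λ { refl → ℕP.<-irrefl refl v<w })
    v∉w+ρ = ∉-+ρ v∉ρ (λ { refl → ℕP.<-irrefl refl v<w })
    cancel : ∀ a b → a * - b + b * a ≡ 0ℤ
    cancel = solve-∀

  path-antisym-< : ∀ {v w} → toℕ v < toℕ w → path v w + path w v ≡ 0ℤ
  path-antisym-< {v} {w} v<w = by-cases (v ∈? ρ) (w ∈? ρ) (≡-dec BoolP._≟_ σ (v +ρ ∪ ⁅ w ⁆))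
    where
    by-cases : Dec (v ∈ ρ) → Dec (w ∈ ρ) → Dec (σ ≡ v +ρ ∪ ⁅ w ⁆) → path v w + path w v ≡ 0ℤ
    by-cases (yes v∈ρ) _         _        = cong₂ _+_ (path-∈ w v∈ρ) (path-∈+ρ w (∈-+ρ w v∈ρ))
    by-cases (no _)    (yes w∈ρ) _        = cong₂ _+_ (path-∈+ρ v (∈-+ρ v w∈ρ)) (path-∈ v w∈ρ)
    by-cases (no v∉ρ)  (no w∉ρ)  (yes σ≡) = path-cancel v∉ρ w∉ρ v<w σ≡
    by-cases (no _)    (no _)    (no σ≢)  =
      cong₂ _+_ (path-≢ v w σ≢) (path-≢ w v (λ σ≡ → σ≢ (trans σ≡ (+ρ-comm w v))))

  path-antisym : ∀ v w → path v w + path w v ≡ 0ℤ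
  path-antisym v w with ℕP.<-cmp (toℕ v) (toℕ w)
  ... | tri< v<w _ _ = path-antisym-< v<w
  ... | tri> _ _ w<v = trans (ℤP.+-comm (path v w) (path w v)) (path-antisym-< w<v)
  ... | tri≈ _ v≡w _ rewrite FinP.toℕ-injective v≡w =
    cong₂ _+_ (path-∈+ρ w (v∈v+ρ w)) (path-∈+ρ w (v∈v+ρ w))

  ∂∂≡0 : sumSubℤ (λ τ → incidence ρ τ * incidence τ σ) ≡ 0ℤ
  ∂∂≡0 = begin
    sumSubℤ (λ τ → incidence ρ τ * incidence τ σ)
      ≡⟨ sumSubℤ-cong (λ τ → trans (cong₂ _*_ (incidence-sum ρ τ) (incidence-sum τ σ))
                                   (sumFinℤ-product (incidenceTerm ρ τ) (incidenceTerm τ σ))) ⟩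
    sumSubℤ (λ τ → sumFinℤ (λ v → sumFinℤ (λ w → incidenceTerm ρ τ v * incidenceTerm τ σ w)))
      ≡⟨ sumSubℤ-sumFinℤ (λ τ v → sumFinℤ (λ w → incidenceTerm ρ τ v * incidenceTerm τ σ w)) ⟩
    sumFinℤ (λ v → sumSubℤ (λ τ → sumFinℤ (λ w → incidenceTerm ρ τ v * incidenceTerm τ σ w)))
      ≡⟨ sumFinℤ-cong (λ v → trans (sumSubℤ-sumFinℤ (λ τ w → incidenceTerm ρ τ v * incidenceTerm τ σ w))
                                   (sumFinℤ-cong (λ w → through-v+ρ v w))) ⟩
    sumFinℤ (λ v → sumFinℤ (path v))
      ≡⟨ sumFinℤ-antisymmetric path path-antisym ⟩
    0ℤ ∎
    where
    open ≡-Reasoning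
    sumFinℤ-product : (f g : Fin n → ℤ) →
      sumFinℤ f * sumFinℤ g ≡ sumFinℤ (λ v → sumFinℤ (λ w → f v * g w))
    sumFinℤ-product f g = trans (ℤP.*-comm (sumFinℤ f) (sumFinℤ g)) (trans (sym (sumFinℤ-*ˡ (sumFinℤ g) f))
      (sumFinℤ-cong (λ v → trans (ℤP.*-comm (sumFinℤ g) (f v)) (sym (sumFinℤ-*ˡ (f v) g)))))
    through-v+ρ : ∀ v w → sumSubℤ (λ τ → incidenceTerm ρ τ v * incidenceTerm τ σ w) ≡ path v w
    through-v+ρ v w =
      sumSubℤ-single _ (v +ρ) (λ τ τ≢ → cong (_* incidenceTerm τ σ w) (incidenceTerm-≢ ρ τ τ≢))

bd-unit : (X Y : Family n) {r : ℕ} {σ : Subset n} → rel X Y (suc r) σ ≡ true →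
  bd X Y r (unit σ) ≗ λ ρ → if rel X Y r ρ then incidence ρ σ else 0ℤ
bd-unit X Y {r} {σ} relσ ρ with rel X Y r ρ
... | false = refl
... | true  = trans (sumSubℤ-single _ σ off-σ)
                    (trans (cong (incidence ρ σ *_) (trans (if-true relσ) (unit-self σ))) (ℤP.*-identityʳ _))
  where
  off-σ : ∀ τ → τ ≢ σ → incidence ρ τ * (if rel X Y (suc r) τ then unit σ τ else 0ℤ) ≡ 0ℤ
  off-σ τ τ≢σ = trans (cong (incidence ρ τ *_) (if-zero (rel X Y (suc r) τ) (unit-≢ (τ≢σ ∘ sym))))
                      (ℤP.*-zeroʳ (incidence ρ τ))

module _ (Δ Y : Family n) (Δ-complex : IsComplex Δ) (Y-complex : IsComplex Y) where

  face-between : ∀ {r ρ τ σ} → rel Δ Y r ρ ≡ true → rel Δ Y (suc (suc r)) σ ≡ true →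
    incidence ρ τ ≢ 0ℤ → incidence τ σ ≢ 0ℤ → rel Δ Y (suc r) τ ≡ true
  face-between {ρ = ρ} {τ} {σ} relρ relσ ρτ≢0 τσ≢0
    with incidence-≢0 ρ τ ρτ≢0 | incidence-≢0 τ σ τσ≢0 | rel-true⁻ Δ Y relρ | rel-true⁻ Δ Y relσ
  ... | v , v∉ρ , refl | w , _ , refl | _ , Yρ , ∣ρ∣ | Δσ , _ , _ =
    rel-true⁺ Δ Y (IsComplex.closed Δ-complex τ σ (SubsetP.p⊆p∪q ⁅ w ⁆) Δσ)
      (BoolP.¬-not λ Yτ → contradiction (IsComplex.closed Y-complex ρ τ (SubsetP.p⊆p∪q ⁅ v ⁆) Yτ)
                                        (λ Yρ′ → contradiction (trans (sym Yρ′) Yρ) λ ()))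
      (trans (∣∪⁅⁆∣ ρ v∉ρ) (cong suc ∣ρ∣))

  bd-bd-unit : ∀ {r σ} → rel Δ Y (suc (suc r)) σ ≡ true → IsZero (bd Δ Y r (bd Δ Y (suc r) (unit σ)))
  bd-bd-unit {r} {σ} relσ ρ with rel Δ Y r ρ in relρ
  ... | false = refl
  ... | true  = trans (sumSubℤ-cong unmask) (∂∂.∂∂≡0 ρ σ)
    where
    mask-harmless : ∀ τ b → (b ≡ false → incidence ρ τ * incidence τ σ ≡ 0ℤ) →
      incidence ρ τ * (if b then (if b then incidence τ σ else 0ℤ) else 0ℤ)
        ≡ incidence ρ τ * incidence τ σ
    mask-harmless τ true  _      = refl
    mask-harmless τ false masked = trans (ℤP.*-zeroʳ (incidence ρ τ)) (sym (masked refl))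
    outside-vanishes : ∀ τ → rel Δ Y (suc r) τ ≡ false → incidence ρ τ * incidence τ σ ≡ 0ℤ
    outside-vanishes τ relτ with incidence ρ τ ℤ.≟ 0ℤ | incidence τ σ ℤ.≟ 0ℤ
    ... | yes ρτ≡0 | _        = cong (_* incidence τ σ) ρτ≡0
    ... | no _     | yes τσ≡0 = trans (cong (incidence ρ τ *_) τσ≡0) (ℤP.*-zeroʳ (incidence ρ τ))
    ... | no ρτ≢0  | no τσ≢0  = contradiction (trans (sym (face-between relρ relσ ρτ≢0 τσ≢0)) relτ) λ ()
    unmask : ∀ τ → incidence ρ τ * (if rel Δ Y (suc r) τ then bd Δ Y (suc r) (unit σ) τ else 0ℤ)
                 ≡ incidence ρ τ * incidence τ σ
    unmask τ = trans
      (cong (λ x → incidence ρ τ * (if rel Δ Y (suc r) τ then x else 0ℤ)) (bd-unit Δ Y relσ τ))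
                     (mask-harmless τ (rel Δ Y (suc r) τ) (outside-vanishes τ))

  bd-unit-isCycle : ∀ k {σ} → rel Δ Y (suc k) σ ≡ true → IsCycle Δ Y k (bd Δ Y k (unit σ))
  bd-unit-isCycle zero    _    = tt
  bd-unit-isCycle (suc k) relσ = bd-bd-unit relσ

-- Enumerating faces

#faces : (Subset n → Bool) → ℕ
#faces T = sumSubℕ (λ σ → if T σ then 1 else 0)

enumerate : (T : Subset n → Bool) → Fin (#faces T) → Subset n
enumerate {zero}  T _ = []
enumerate {suc n} T = ((false ∷_) ∘ enumerate (T ∘ (false ∷_))) ++ ((true ∷_) ∘ enumerate (T ∘ (true ∷_)))

enumerate-∈ : (T : Subset n → Bool) (i : Fin (#faces T)) → T (enumerate T i) ≡ true
enumerate-∈ {zero} T i with T []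
enumerate-∈ {zero} T zero | true = refl
enumerate-∈ {suc n} T =
  ++-all (λ σ → T σ ≡ true) (enumerate-∈ (T ∘ (false ∷_))) (enumerate-∈ (T ∘ (true ∷_)))

enumerate-injective : (T : Subset n → Bool) (i j : Fin (#faces T)) → enumerate T i ≡ enumerate T j → i ≡ j
enumerate-injective {zero} T i j _ with T []
enumerate-injective {zero} T zero zero _ | true = refl
enumerate-injective {suc n} T = ++-injective
  (λ a b eq → enumerate-injective (T ∘ (false ∷_)) a b (cong tail eq))
  (λ a b eq → enumerate-injective (T ∘ (true ∷_)) a b (cong tail eq))
  (λ a b ())

enumerate-surjective : (T : Subset n → Bool) {σ : Subset n} → T σ ≡ true → ∃ λ i → enumerate T i ≡ σ
enumerate-surjective {zero} T {[]} Tσ with T []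
enumerate-surjective {zero} T {[]} refl | true = zero , refl
enumerate-surjective {suc n} T {false ∷ σ} Tσ with enumerate-surjective (T ∘ (false ∷_)) Tσ
... | i , refl = i ↑ˡ _ ,
  VectorP.lookup-++ˡ ((false ∷_) ∘ enumerate (T ∘ (false ∷_))) ((true ∷_) ∘ enumerate (T ∘ (true ∷_))) i
enumerate-surjective {suc n} T {true ∷ σ} Tσ with enumerate-surjective (T ∘ (true ∷_)) Tσ
... | i , refl = _ ↑ʳ i ,
  VectorP.lookup-++ʳ ((false ∷_) ∘ enumerate (T ∘ (false ∷_))) ((true ∷_) ∘ enumerate (T ∘ (true ∷_))) i

count≡count+#faces-rel : (X Y : Family n) (s : ℕ) → (∀ σ → Y σ ≡ true → X σ ≡ true) →
  count X s ≡ count Y s ℕ.+ #faces (rel X Y s)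
count≡count+#faces-rel X Y s Y⊆X =
  trans (sumSubℕ-cong split)
        (sumSubℕ-+ (λ σ → if Y σ ∧ (∣ σ ∣ ≡ᵇ s) then 1 else 0) (λ σ → if rel X Y s σ then 1 else 0))
  where
  split : ∀ σ → (if X σ ∧ (∣ σ ∣ ≡ᵇ s) then 1 else 0)
              ≡ (if Y σ ∧ (∣ σ ∣ ≡ᵇ s) then 1 else 0) ℕ.+ (if rel X Y s σ then 1 else 0)
  split σ with X σ | Y σ | Y⊆X σ | ∣ σ ∣ ≡ᵇ s
  ... | true  | true  | _ | true  = refl
  ... | true  | true  | _ | false = refl
  ... | true  | false | _ | true  = refl
  ... | true  | false | _ | false = refl
  ... | false | false | _ | _     = refl
  ... | false | true  | Y⊆Xσ | _ = contradiction (Y⊆Xσ refl) λ ()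

module _ (T : Subset n → Bool) where

  units-independent : Independent (unit ∘ enumerate T)
  units-independent c c≡0 a = begin
    c a                                   ≡⟨ sym (ℤP.*-identityʳ (c a)) ⟩
    c a * 1ℤ                              ≡⟨ cong (c a *_) (sym (unit-self (enumerate T a))) ⟩
    c a * unit (enumerate T a) (enumerate T a)
      ≡⟨ sym (sumFinℤ-single (λ b → c b * unit (enumerate T b) (enumerate T a)) a off-a) ⟩
    lincomb c (unit ∘ enumerate T) (enumerate T a)
      ≡⟨ c≡0 (enumerate T a) ⟩
    0ℤ                                    ∎
    where
    open ≡-Reasoning
    off-a : ∀ b → b ≢ a → c b * unit (enumerate T b) (enumerate T a) ≡ 0ℤ
    off-a b b≢a = trans (cong (c b *_) (unit-≢ (b≢a ∘ enumerate-injective T b a))) (ℤP.*-zeroʳ (c b))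

  supportedOn⇒lincomb : {d : Chain n} → SupportedOn T d → d ≗ lincomb (d ∘ enumerate T) (unit ∘ enumerate T)
  supportedOn⇒lincomb {d} d-supp σ with T σ in Tσ
  ... | false = trans (d-supp σ Tσ) (sym (lincomb-zeroʳ (d ∘ enumerate T) (unit ∘ enumerate T) σ
                  λ a → unit-≢ λ { refl → contradiction (trans (sym (enumerate-∈ T a)) Tσ) λ () }))
  ... | true with enumerate-surjective T Tσ
  ...   | a , refl = sym (trans (sumFinℤ-single _ a off-a)
                                 (trans (cong (d σ *_) (unit-self σ)) (ℤP.*-identityʳ (d σ))))
    where
    off-a : ∀ b → b ≢ a → d (enumerate T b) * unit (enumerate T b) (enumerate T a) ≡ 0ℤ
    off-a b b≢a = trans (cong (d (enumerate T b) *_) (unit-≢ (b≢a ∘ enumerate-injective T b a)))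
                        (ℤP.*-zeroʳ (d (enumerate T b)))

-- Rank, homology and kernel of the relative boundary

module RelativeBoundary (Δ Y : Family n) (k : ℕ) where

  D : Chain n → Chain n
  D = bd Δ Y k

  D-lincomb : (c : Fin m → ℤ) (z : Fin m → Chain n) → D (lincomb c z) ≗ lincomb c (D ∘ z)
  D-lincomb = bd-lincomb Δ Y k

  IsBoundaryOf : (Subset n → Bool) → Chain n → Set
  IsBoundaryOf T w = ∃ λ d → SupportedOn T d × D d ≗ w

  IsRelativeCycle : Chain n → Set
  IsRelativeCycle w = Supp Δ Y k w × IsCycle Δ Y k w

  -- For a set T of k-faces, the maximal sizes of these families are the rank of D on ℤ^T,
  -- the rank of (relative cycles)/D(ℤ^T) and the rank of the kernel of D on ℤ^T.
  Columns Homology Kernel : (Subset n → Bool) → ℕ → Set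
  Columns T  = IndependentFamily unit (λ τ → T τ ≡ true) (IsZero ∘ D)
  Homology T = IndependentFamily id IsRelativeCycle (IsBoundaryOf T)
  Kernel T   = IndependentFamily id (λ w → SupportedOn T w × IsZero (D w)) IsZero

  module _ {T : Subset n → Bool} {ρ : ℕ} (maxColumns : IsMax (Columns T) ρ) where

    columnFaces : Fin ρ → Subset n
    columnFaces = proj₁ (proj₁ maxColumns)

    column-inRatSpan : ∀ {σ} → T σ ≡ true → InRatSpan (D ∘ unit ∘ columnFaces) (D (unit σ))
    column-inRatSpan {σ} Tσ = do
      (l , l≢0 , c , Dlc≡0) ← maximal-dependence unit (λ τ → T τ ≡ true) (IsZero ∘ D)
        (λ x≗y Dx≡0 τ → trans (sym (bd-cong Δ Y k x≗y τ)) (Dx≡0 τ)) maxColumns Tσ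
      dependence⇒inRatSpan c l≢0 λ τ →
        trans (sym (D-lincomb (l Vector.∷ c) (unit ∘ (σ Vector.∷ columnFaces)) τ)) (Dlc≡0 τ)

    boundary-inRatSpan : ∀ {d} → SupportedOn T d → InRatSpan (D ∘ unit ∘ columnFaces) (D d)
    boundary-inRatSpan {d} d-supp = inRatSpan-cong
      (λ σ → sym (trans (bd-cong Δ Y k (supportedOn⇒lincomb T d-supp) σ)
                        (D-lincomb (d ∘ enumerate T) (unit ∘ enumerate T) σ)))
      (inRatSpan-lincomb (d ∘ enumerate T) (λ a → column-inRatSpan (enumerate-∈ T a)))

    module _ {b : ℕ} (maxHomology : IsMax (Homology T) b) where

      homologyBasis : Fin b → Chain n
      homologyBasis = proj₁ (proj₁ maxHomology)

      cycle-inRatSpan : ∀ {w} → IsRelativeCycle w → InRatSpan ((D ∘ unit ∘ columnFaces) ++ homologyBasis) w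
      cycle-inRatSpan {w} w-cycle = do
        (l , l≢0 , c , d , d-supp , Dd≗) ← maximal-dependence id IsRelativeCycle (IsBoundaryOf T)
          (λ x≗y (d , d-supp , Dd≗x) → d , d-supp , λ σ → trans (Dd≗x σ) (x≗y σ)) maxHomology w-cycle
        inRatSpan-cancel l≢0 (inRatSpan-cong
          (λ σ → trans (cong (_+ _) (Dd≗ σ)) (+-lincomb-neg (l * w σ) c homologyBasis σ))
          (inRatSpan-+ (inRatSpan-++ˡ (boundary-inRatSpan d-supp))
                       (inRatSpan-++ʳ (lincomb-inRatSpan homologyBasis (λ a → - c a)))))

    module _ {b₀ : ℕ} (maxKernel : IsMax (Kernel T) b₀) where

      kernelBasis : Fin b₀ → Chain n
      kernelBasis = proj₁ (proj₁ maxKernel)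

      kernel-inRatSpan : ∀ {w} → SupportedOn T w → IsZero (D w) → InRatSpan kernelBasis w
      kernel-inRatSpan w-supp Dw≡0 = do
        (l , l≢0 , c , lc≡0) ← maximal-dependence id (λ w → SupportedOn T w × IsZero (D w)) IsZero
          (λ x≗y x≡0 σ → trans (sym (x≗y σ)) (x≡0 σ)) maxKernel (w-supp , Dw≡0)
        dependence⇒inRatSpan c l≢0 lc≡0

      columns++kernel : Fin (ρ ℕ.+ b₀) → Chain n
      columns++kernel = (unit ∘ columnFaces) ++ kernelBasis

      columns++kernel-independent : Independent columns++kernel
      columns++kernel-independent = ++-independent λ c d sum≡0 →
        let units≗ : lincomb c (unit ∘ columnFaces) ≗ lincomb (λ b → - d b) kernelBasis
            units≗ σ = trans (inverseˡ-unique _ _ (sum≡0 σ)) (sym (lincomb-neg d kernelBasis σ))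
            c≡0 = proj₂ (proj₂ (proj₁ maxColumns)) c λ σ → trans (bd-cong Δ Y k units≗ σ)
                    (trans (D-lincomb (λ b → - d b) kernelBasis σ)
                           (lincomb-zeroʳ (λ b → - d b) (D ∘ kernelBasis) σ (λ b → kernel-cycle b σ)))
        in c≡0 , proj₂ (proj₂ (proj₁ maxKernel)) d λ σ → trans (sym (ℤP.+-identityˡ _))
                   (trans (cong (_+ _) (sym (lincomb-zeroˡ (unit ∘ columnFaces) c≡0 σ))) (sum≡0 σ))
        where kernel-cycle = λ b → proj₂ (proj₁ (proj₂ (proj₁ maxKernel)) b)

      columns++kernel-supportedOn : ∀ i → SupportedOn T (columns++kernel i)
      columns++kernel-supportedOn = ++-all (SupportedOn T)
        (λ a → unit-supportedOn T (proj₁ (proj₂ (proj₁ maxColumns)) a))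
        (λ b → proj₁ (proj₁ (proj₂ (proj₁ maxKernel)) b))

      -- Some l·(unit σ) agrees with a combination of the column units up to an element of ker D.
      unit-inRatSpan : ∀ {σ} → T σ ≡ true → InRatSpan columns++kernel (unit σ)
      unit-inRatSpan {σ} Tσ = do
        (l , l≢0 , e , lDu≗) ← column-inRatSpan Tσ
        let coefficients = l Vector.∷ (λ b → - e b)
            faces = σ Vector.∷ columnFaces
            x-supported = lincomb-supportedOn T coefficients {unit ∘ faces} λ where
              zero    → unit-supportedOn T Tσ
              (suc b) → unit-supportedOn T (proj₁ (proj₂ (proj₁ maxColumns)) b)
            Dx≡0 τ = trans (D-lincomb coefficients (unit ∘ faces) τ)
              (trans (cong₂ _+_ (lDu≗ τ) (lincomb-neg e (D ∘ unit ∘ columnFaces) τ))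
                   (ℤP.+-inverseʳ (lincomb e (D ∘ unit ∘ columnFaces) τ)))
        inRatSpan-cancel l≢0 (inRatSpan-cong (λ τ → +-neg-lincomb (l * unit σ τ) e (unit ∘ columnFaces) τ)
          (inRatSpan-+ (inRatSpan-++ʳ (kernel-inRatSpan x-supported Dx≡0))
                       (inRatSpan-++ˡ (lincomb-inRatSpan (unit ∘ columnFaces) e))))

      rank-nullity : ¬ ¬ (ρ ℕ.+ b₀ ≡ #faces T)
      rank-nullity = ℕP.≤-antisym ≤#faces <$>
        independent-inRatSpan⇒≤ columns++kernel (units-independent T) (λ a → unit-inRatSpan (enumerate-∈ T a))
        where
        ≤#faces = independent⇒≤ (unit ∘ enumerate T) (λ i → columns++kernel i ∘ enumerate T)
          columns++kernel-independent (λ i → supportedOn⇒lincomb T (columns++kernel-supportedOn i))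

  columns-bound : {T : Subset n → Bool} → ∀ m → Columns T m → m ≤ #faces T
  columns-bound {T} m (τ , τ∈ , τ-indep) =
    independent⇒≤ (unit ∘ enumerate T) (λ a → unit (τ a) ∘ enumerate T)
      (λ c c≡0 → τ-indep c (bd-zero Δ Y k c≡0)) (λ a → supportedOn⇒lincomb T (unit-supportedOn T (τ∈ a)))

  maxColumns-exists : (T : Subset n → Bool) → ¬ ¬ ∃ (IsMax (Columns T))
  maxColumns-exists T = isMax-exists (Columns T) (#faces T) columns-bound ((λ ()) , (λ ()) , λ _ _ ())

  columns+homology-≤ : {T₁ T₂ : Subset n → Bool} {ρ₁ b₁ ρ₂ b₂ : ℕ} →
    Columns T₁ ρ₁ → Homology T₁ b₁ →
    (maxColumns₂ : IsMax (Columns T₂) ρ₂) (maxHomology₂ : IsMax (Homology T₂) b₂) →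
    let generators₂ = (D ∘ unit ∘ columnFaces {T₂} maxColumns₂) ++ homologyBasis {T₂} maxColumns₂ maxHomology₂ in
    (∀ {σ} → T₁ σ ≡ true → InRatSpan generators₂ (D (unit σ))) →
    ¬ ¬ (ρ₁ ℕ.+ b₁ ≤ ρ₂ ℕ.+ b₂)
  columns+homology-≤ {T₁} {T₂} (τ , τ∈ , τ-indep) (z , z-cycle , z-indep) maxColumns₂ maxHomology₂ column∈ =
    independent-inRatSpan⇒≤ _ F-independent (++-all (InRatSpan _)
      (λ a → column∈ (τ∈ a)) (λ b → cycle-inRatSpan {T₂} maxColumns₂ maxHomology₂ (z-cycle b)))
    where
    G = D ∘ unit ∘ τ
    F-independent : Independent (G ++ z)
    F-independent = ++-independent λ c d sum≡0 →
      let d≡0 = z-indep d (lincomb (λ a → - c a) (unit ∘ τ) ,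
                           lincomb-supportedOn T₁ (λ a → - c a) {unit ∘ τ} (unit-supportedOn T₁ ∘ τ∈) ,
                           λ σ → trans (D-lincomb (λ a → - c a) (unit ∘ τ) σ)
                                       (trans (lincomb-neg c G σ) (sym (inverseʳ-unique _ _ (sum≡0 σ)))))
      in τ-indep c (λ σ → trans (D-lincomb c (unit ∘ τ) σ) (trans (sym (ℤP.+-identityʳ _))
           (trans (cong (lincomb c G σ +_) (sym (lincomb-zeroˡ z d≡0 σ))) (sum≡0 σ)))) , d≡0

-- Comparing X with Δ

module Subcomplex {n : ℕ} (k : ℕ) (Δ X Y : Family n)
  (X-below : ∀ σ → ∣ σ ∣ ≤ k → σ ∈F Δ → σ ∈F X)
  (X-above : ∀ σ → σ ∈F X → σ ∈F Δ × ∣ σ ∣ ≤ suc k) where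

  open RelativeBoundary Δ Y k

  Xₖ∖Yₖ Δₖ∖Yₖ : Subset n → Bool
  Xₖ∖Yₖ = rel X Y (suc k)
  Δₖ∖Yₖ = rel Δ Y (suc k)

  X≡Δ-below : ∀ {σ} → ∣ σ ∣ ≤ k → X σ ≡ Δ σ
  X≡Δ-below {σ} ∣σ∣≤k with X σ in Xσ | Δ σ in Δσ
  ... | true  | true  = refl
  ... | false | false = refl
  ... | true  | false = contradiction (trans (sym (proj₁ (X-above σ Xσ))) Δσ) λ ()
  ... | false | true  = contradiction (trans (sym (X-below σ ∣σ∣≤k Δσ)) Xσ) λ ()

  rel-below : ∀ {s} → s ≤ k → ∀ σ → rel X Y s σ ≡ rel Δ Y s σ
  rel-below {s} s≤k σ with ∣ σ ∣ ≡ᵇ s in ∣σ∣≡ᵇs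
  ... | true  = cong (λ b → b ∧ not (Y σ) ∧ true)
                     (X≡Δ-below (subst (_≤ k) (sym (ℕP.≡ᵇ⇒≡ _ _ (subst T (sym ∣σ∣≡ᵇs) tt))) s≤k))
  ... | false = trans (∧false (X σ)) (sym (∧false (Δ σ)))
    where ∧false : ∀ a → a ∧ not (Y σ) ∧ false ≡ false
          ∧false a = trans (cong (a ∧_) (BoolP.∧-zeroʳ (not (Y σ)))) (BoolP.∧-zeroʳ a)

  Xₖ∖Yₖ⊆Δₖ∖Yₖ : ∀ {σ} → Xₖ∖Yₖ σ ≡ true → Δₖ∖Yₖ σ ≡ true
  Xₖ∖Yₖ⊆Δₖ∖Yₖ relσ with rel-true⁻ X Y relσ
  ... | Xσ , Yσ , ∣σ∣ = rel-true⁺ Δ Y (proj₁ (X-above _ Xσ)) Yσ ∣σ∣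

  bd-X≗D : ∀ {d} → SupportedOn Xₖ∖Yₖ d → bd X Y k d ≗ D d
  bd-X≗D {d} d-supp σ rewrite rel-below ℕP.≤-refl σ with rel Δ Y k σ
  ... | false = refl
  ... | true  = sumSubℤ-cong λ τ → cong (incidence σ τ *_) (same-mask τ)
    where
    same-mask : ∀ τ → (if Xₖ∖Yₖ τ then d τ else 0ℤ) ≡ (if Δₖ∖Yₖ τ then d τ else 0ℤ)
    same-mask τ with Xₖ∖Yₖ τ in Wτ | Δₖ∖Yₖ τ in Vτ
    ... | true  | true  = refl
    ... | false | false = refl
    ... | true  | false = contradiction (trans (sym (Xₖ∖Yₖ⊆Δₖ∖Yₖ Wτ)) Vτ) λ ()
    ... | false | true  = sym (d-supp τ Wτ)

  bd-X-below : ∀ {r} → suc r ≤ k → ∀ d → bd X Y r d ≗ bd Δ Y r d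
  bd-X-below {r} r<k d σ rewrite rel-below (ℕP.<⇒≤ r<k) σ with rel Δ Y r σ
  ... | false = refl
  ... | true  = sumSubℤ-cong λ τ → cong (λ b → incidence σ τ * (if b then d τ else 0ℤ)) (rel-below r<k τ)

  isCycle-X→Δ : ∀ {s w} → s ≤ k → IsCycle X Y s w → IsCycle Δ Y s w
  isCycle-X→Δ {zero}  _   _   = tt
  isCycle-X→Δ {suc r} {w} r<k cyc σ = trans (sym (bd-X-below r<k w σ)) (cyc σ)

  isCycle-Δ→X : ∀ {s w} → s ≤ k → IsCycle Δ Y s w → IsCycle X Y s w
  isCycle-Δ→X {zero}  _   _   = tt
  isCycle-Δ→X {suc r} {w} r<k cyc σ = trans (bd-X-below r<k w σ) (cyc σ)

  bd-X-top : ∀ d → IsZero (bd X Y (suc k) d)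
  bd-X-top d σ with rel X Y (suc k) σ
  ... | false = refl
  ... | true  = sumSubℤ-zero λ τ →
    trans (cong (incidence σ τ *_) (if-false (no-face τ))) (ℤP.*-zeroʳ (incidence σ τ))
    where
    no-face : ∀ τ → rel X Y (suc (suc k)) τ ≡ false
    no-face τ with rel X Y (suc (suc k)) τ in relτ
    ... | false = refl
    ... | true with rel-true⁻ X Y relτ
    ...   | Xτ , _ , ∣τ∣ = contradiction (subst (_≤ suc k) ∣τ∣ (proj₂ (X-above τ Xτ))) (ℕP.n≮n (suc k))

  homology-X→ : ∀ {m} → IndepHom X Y k m → Homology Xₖ∖Yₖ m
  homology-X→ (z , z∈ , indep) = z ,
    (λ a → (λ σ relσ → proj₁ (z∈ a) σ (trans (rel-below ℕP.≤-refl σ) relσ)) ,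
           isCycle-X→Δ ℕP.≤-refl (proj₂ (z∈ a))) ,
    λ c (d , d-supp , D≗) → indep c (d , d-supp , λ σ → trans (bd-X≗D d-supp σ) (D≗ σ))

  homology-X← : ∀ {m} → Homology Xₖ∖Yₖ m → IndepHom X Y k m
  homology-X← (z , z∈ , indep) = z ,
    (λ a → (λ σ relσ → proj₁ (z∈ a) σ (trans (sym (rel-below ℕP.≤-refl σ)) relσ)) ,
           isCycle-Δ→X ℕP.≤-refl (proj₂ (z∈ a))) ,
    λ c (d , d-supp , bd≗) → indep c (d , d-supp , λ σ → trans (sym (bd-X≗D d-supp σ)) (bd≗ σ))

  kernel-X→ : ∀ {m} → IndepHom X Y (suc k) m → Kernel Xₖ∖Yₖ m
  kernel-X→ (z , z∈ , indep) = z ,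
    (λ a → proj₁ (z∈ a) , λ σ → trans (sym (bd-X≗D (proj₁ (z∈ a)) σ)) (proj₂ (z∈ a) σ)) ,
    λ c c≡0 → indep c ((λ _ → 0ℤ) , (λ _ _ → refl) , λ σ → trans (bd-X-top _ σ) (sym (c≡0 σ)))

  kernel-X← : ∀ {m} → Kernel Xₖ∖Yₖ m → IndepHom X Y (suc k) m
  kernel-X← (z , z∈ , indep) = z ,
    (λ a → proj₁ (z∈ a) , λ σ → trans (bd-X≗D (proj₁ (z∈ a)) σ) (proj₂ (z∈ a) σ)) ,
    λ c (d , _ , bd≗) → indep c λ σ → trans (sym (bd≗ σ)) (bd-X-top d σ)

  rank-betti-relations : IsComplex Δ → IsComplex Y → ∀ {r b b′ b₀} →
    RankBd Δ Y k r → Betti X Y k b → Betti Δ Y k b′ → Betti X Y (suc k) b₀ →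
    ¬ ¬ (∃ λ ρ → ρ ℕ.+ b₀ ≡ #faces Xₖ∖Yₖ × ρ ℕ.+ b ≡ r ℕ.+ b′)
  rank-betti-relations Δ-complex Y-complex maxRank bettiX bettiΔ bettiX₀ = do
    (ρ , maxColumns) ← maxColumns-exists Xₖ∖Yₖ
    let maxHomology = IsMax-transport (λ _ → homology-X→) (λ _ → homology-X←) bettiX
        maxKernel   = IsMax-transport (λ _ → kernel-X→) (λ _ → kernel-X←) bettiX₀
    nullity ← rank-nullity maxColumns maxKernel
    ≤ ← columns+homology-≤ (proj₁ maxColumns) (proj₁ maxHomology) maxRank bettiΔ
           (λ σ∈ → inRatSpan-++ˡ (column-inRatSpan maxRank (Xₖ∖Yₖ⊆Δₖ∖Yₖ σ∈)))
    ≥ ← columns+homology-≤ (proj₁ maxRank) (proj₁ bettiΔ) maxColumns maxHomology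
           (λ {σ} σ∈ → cycle-inRatSpan maxColumns maxHomology
                         (bd-supportedOn Δ Y k (unit σ) , bd-unit-isCycle Δ Y Δ-complex Y-complex k σ∈))
    pure (ρ , nullity , ℕP.≤-antisym ≤ ≥)

two-of-three : ∀ {ρ b₀ N b r b′ : ℕ} → ρ ℕ.+ b₀ ≡ N → ρ ℕ.+ b ≡ r ℕ.+ b′ →
  (N ≡ r × b ≡ b′ → b₀ ≡ 0) × (N ≡ r × b₀ ≡ 0 → b ≡ b′) × (b ≡ b′ × b₀ ≡ 0 → N ≡ r)
two-of-three {ρ} {b₀} {N} {b} {r} {b′} nullity homology =
  (λ (N≡r , b≡b′) → ℕP.+-cancelˡ-≡ ρ b₀ 0
     (trans nullity (trans N≡r (trans (sym (ρ≡r b≡b′)) (sym (ℕP.+-identityʳ ρ)))))) ,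
  (λ (N≡r , b₀≡0) → ℕP.+-cancelˡ-≡ r b b′ (trans (cong (ℕ._+ b) (sym (trans (ρ≡N b₀≡0) N≡r))) homology)) ,
  (λ (b≡b′ , b₀≡0) → trans (sym (ρ≡N b₀≡0)) (ρ≡r b≡b′))
  where
  ρ≡r : b ≡ b′ → ρ ≡ r
  ρ≡r refl = ℕP.+-cancelʳ-≡ b ρ r homology
  ρ≡N : b₀ ≡ 0 → ρ ≡ N
  ρ≡N refl = trans (sym (ℕP.+-identityʳ ρ)) nullity

lemma2p7 : ∀ {n : ℕ} (k j : ℕ) (Δ X Y : Family n)
    → IsComplex Δ → InC k Δ X → InC j X Y
    → (r b b′ b₀ : ℕ)
    → RankBd Δ Y k r
    → Betti X Y k b
    → Betti Δ Y k b′
    → Betti X Y (suc k) b₀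
    → ((count X (suc k) ≡ count Y (suc k) ℕ.+ r) × (b ≡ b′) → b₀ ≡ 0)
    × ((count X (suc k) ≡ count Y (suc k) ℕ.+ r) × (b₀ ≡ 0) → b ≡ b′)
    × ((b ≡ b′) × (b₀ ≡ 0) → count X (suc k) ≡ count Y (suc k) ℕ.+ r)
lemma2p7 k j Δ X Y Δ-complex (_ , X-below , X-above) (Y-complex , _ , Y-above) r b b′ b₀ rank bettiX bettiΔ bettiX₀ =
  (λ (X≡Y+r , b≡b′) → conclude (b₀ ℕ.≟ 0) λ nullity homology →
     proj₁ (two-of-three nullity homology) (N≡r X≡Y+r , b≡b′)) ,
  (λ (X≡Y+r , b₀≡0) → conclude (b ℕ.≟ b′) λ nullity homology →
     proj₁ (proj₂ (two-of-three nullity homology)) (N≡r X≡Y+r , b₀≡0)) ,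
  (λ (b≡b′ , b₀≡0) → conclude (count X (suc k) ℕ.≟ count Y (suc k) ℕ.+ r) λ nullity homology →
     trans X≡Y+N (cong (count Y (suc k) ℕ.+_) (proj₂ (proj₂ (two-of-three nullity homology)) (b≡b′ , b₀≡0))))
  where
  open Subcomplex k Δ X Y X-below X-above
  X≡Y+N : count X (suc k) ≡ count Y (suc k) ℕ.+ #faces Xₖ∖Yₖ
  X≡Y+N = count≡count+#faces-rel X Y (suc k) (λ σ → proj₁ ∘ Y-above σ)
  N≡r : count X (suc k) ≡ count Y (suc k) ℕ.+ r → #faces Xₖ∖Yₖ ≡ r
  N≡r = ℕP.+-cancelˡ-≡ (count Y (suc k)) _ _ ∘ trans (sym X≡Y+N)
  conclude : ∀ {P : Set} → Dec P → (∀ {ρ} → ρ ℕ.+ b₀ ≡ #faces Xₖ∖Yₖ → ρ ℕ.+ b ≡ r ℕ.+ b′ → P) → P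
  conclude P? relations⇒P = decidable-stable P? ((λ (_ , nullity , homology) → relations⇒P nullity homology)
    <$> rank-betti-relations Δ-complex Y-complex rank bettiX bettiΔ bettiX₀)
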